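{- For every $n\ge 8$, $\mu(M(C_n))=n+\left\lfloor \frac{n}{4}\right\rfloor$, where $C_n$ is the cycle on $n$ vertices.
   Context: All graphs are finite and simple. The Mycielskian $M(G)$ of a graph $G$ has vertex set $V(G)\cup V(G')\cup\{v^*\}$, where $V(G')=\{u': u\in V(G)\}$, and edge set $E(G)\cup\{uv': uv\in E(G)\}\cup\{v'v^*: v'\in V(G')\}$ (so for each edge $uv$ of $G$ both $uv'$ and $vu'$ are edges). Given $S\subseteq V(H)$, two vertices $x,y$ are $S$-visible if some shortest $x,y$-path in $H$ has no internal vertex in $S$; $S$ is a mutual-visibility set if every two vertices of $S$ are $S$-visible; $\mu(H)$ is the maximum size of a mutual-visibility set of $H$. -}

module Defs where

open import Data.Nat using (ℕ; zero; suc; _≤_)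
open import Data.Fin using (Fin; toℕ)
open import Data.Sum using (_⊎_; inj₁; inj₂)
open import Data.Product using (_×_; Σ; ∃; ∃-syntax)
open import Data.Unit using (⊤; tt)
open import Data.Empty using (⊥)
open import Data.List using (List; []; _∷_; length)
open import Data.List.Relation.Unary.All using (All)
open import Data.List.Relation.Unary.Unique.Propositional using (Unique)
open import Data.List.Membership.Propositional using (_∈_)
open import Relation.Nullary using (¬_)
open import Relation.Binary.PropositionalEquality using (_≡_)

record Graph : Set₁ where
  field
    V   : Set
    Adj : V → V → Set
open Graph public

CycleAdj : (n : ℕ) → Fin n → Fin n → Set
CycleAdj n i j =
  (suc (toℕ i) ≡ toℕ j) ⊎ (suc (toℕ j) ≡ toℕ i)
  ⊎ ((suc (toℕ i) ≡ n × toℕ j ≡ 0) ⊎ (suc (toℕ j) ≡ n × toℕ i ≡ 0))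

Cycle : ℕ → Graph
Cycle n = record { V = Fin n ; Adj = CycleAdj n }

-- Mycielskian: vertices inj₁ u (= u), inj₂ (inj₁ u) (= u'), inj₂ (inj₂ tt) (= v*).
MycAdj : (G : Graph) → V G ⊎ (V G ⊎ ⊤) → V G ⊎ (V G ⊎ ⊤) → Set
MycAdj G (inj₁ u)        (inj₁ v)        = Adj G u v
MycAdj G (inj₁ u)        (inj₂ (inj₁ v)) = Adj G u v
MycAdj G (inj₂ (inj₁ u)) (inj₁ v)        = Adj G u v
MycAdj G (inj₂ (inj₁ u)) (inj₂ (inj₂ _)) = ⊤
MycAdj G (inj₂ (inj₂ _)) (inj₂ (inj₁ v)) = ⊤
MycAdj G _               _               = ⊥

Mycielskian : Graph → Graph
Mycielskian G = record { V = V G ⊎ (V G ⊎ ⊤) ; Adj = MycAdj G }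

module _ (H : Graph) where

  data Walk : V H → V H → ℕ → Set where
    nil  : ∀ {x} → Walk x x 0
    cons : ∀ {x z y k} → Adj H x z → Walk z y k → Walk x y (suc k)

  initVerts : ∀ {x y k} → Walk x y k → List (V H)
  initVerts nil = []
  initVerts (cons {x = x} e w) = x ∷ initVerts w

  interior : ∀ {x y k} → Walk x y k → List (V H)
  interior nil = []
  interior (cons e w) = initVerts w

  IsShortest : ∀ {x y k} → Walk x y k → Set
  IsShortest {x} {y} {k} w = ∀ k' → Walk x y k' → k ≤ k'

  Visible : List (V H) → V H → V H → Set
  Visible S x y = ∃[ k ] Σ (Walk x y k) (λ w → IsShortest w × All (λ v → ¬ (v ∈ S)) (interior w))

  IsMutualVisibilitySet : List (V H) → Set
  IsMutualVisibilitySet S = ∀ x y → x ∈ S → y ∈ S → Visible S x y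

  -- μ(H) = m  (S ranges over duplicate-free lists, i.e. finite vertex sets)
  MuEquals : ℕ → Set
  MuEquals m =
    (∃[ S ] (Unique S × IsMutualVisibilitySet S × length S ≡ m))
    × (∀ S → Unique S → IsMutualVisibilitySet S → length S ≤ m)

-- Write u_i, u′_i (i mod n) and v* for the vertices of M(C_n). The distance between two vertices
-- depends only on their kinds and on the cyclic distance of their indices.
--
-- Lower bound: among the first 4⌊n/4⌋ positions take u_i for i ≡ 0, 2 and u′_i for i ≢ 1 (mod 4),
-- and take u′_i for all later positions. Every pair of chosen vertices is joined by an explicit
-- shortest path whose inner vertices are not chosen.
--
-- Upper bound: a few local configurations cannot occur in a mutual-visibility set S, because every
-- shortest path between two of their vertices passes through a third. If v* ∈ S they leave at most
-- one vertex of S per fibre {u_i, u′_i} on average. If v* ∉ S and u′_i, u_{i+1}, u′_{i+2} ∈ S, then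
-- S lies close to u_{i+1} and |S| ≤ 10. Otherwise the fibres hold at most 5/4 vertices on average.
-- Both averages come from local inequalities K·|S_i| + Φ(i+1) ≤ C + Φ(i) for a potential Φ on
-- windows of consecutive fibres, which telescope around the cycle; the finitely many windows are
-- checked by evaluation.

module Submission where

open import Defs
open import Data.Bool using (Bool; true; false; T; not; _∧_; _∨_)
open import Data.Bool.Properties using (T?; T-∧) renaming (_≟_ to _≟ᵇ_)
open import Data.Empty using (⊥; ⊥-elim)
open import Data.Fin as Fin using (Fin; toℕ; fromℕ<)
open import Data.Fin.Properties using (toℕ-injective; toℕ-fromℕ<; toℕ<n; toℕ-inject₁; toℕ-fromℕ; any?) renaming (_≟_ to _≟ᶠ_)
open import Data.List using (List; []; _∷_; _++_; length; tabulate; map; filterᵇ)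
open import Data.List.Properties using (filter-++; length-++; map-++)
open import Data.List.Membership.Propositional using (_∈_; _∉_)
open import Data.List.Membership.Propositional.Properties
  using (∈-++⁺ˡ; ∈-++⁺ʳ; ∈-tabulate⁺; ∈-tabulate⁻; ∈-map⁺; ∈-filter⁻)
open import Data.List.Relation.Unary.All using (All; []; _∷_)
import Data.List.Relation.Unary.AllPairs as AllPairs
open import Data.List.Relation.Unary.Any using (here; there)
open import Data.List.Relation.Unary.Unique.Propositional using (Unique)
open import Data.List.Relation.Unary.Unique.Propositional.Properties using (Unique[x∷xs]⇒x∉xs; filter⁺; ++⁺; tabulate⁺)
open import Data.Nat using (ℕ; zero; suc; _≤_; _<_; _+_; _*_; _∸_; _/_; _%_; ∣_-_∣; z≤n; s≤s; s≤s⁻¹; z<s; _≟_; _≤?_; _<?_)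
open import Data.Nat.DivMod
open import Data.Nat.Properties
open import Algebra.Properties.Semiring.Sum +-*-semiring
  using (sum; sum-syntax; sum-cong-≗; sum-init-last; ∑-distrib-+; *-distribˡ-sum)
open import Data.Nat.Tactic.RingSolver using (solve-∀)
open import Data.Product using (_×_; Σ; ∃-syntax; _,_; proj₁; proj₂)
open import Data.Product.Properties using () renaming (≡-dec to ×-≡-dec)
open import Data.Sum using (_⊎_; inj₁; inj₂; swap)
open import Data.Sum.Properties using (≡-dec)
open import Data.Unit using (tt) renaming (_≟_ to _≟ᵗ_)
open import Function using (_∘_)
open import Function.Bundles using (Equivalence)
open import Relation.Binary using (tri<; tri≈; tri>; DecidableEquality)
open import Relation.Binary.PropositionalEquality using (_≡_; _≢_; refl; sym; trans; cong; cong₂; subst; subst₂; module ≡-Reasoning)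
open import Relation.Nullary using (¬_; Dec; yes; no; does)
open import Relation.Nullary.Decidable using (dec-true; dec-false; _⊎-dec_; _×-dec_; _→-dec_; map′; True; toWitness)

least : {A : ℕ → Set} → (∀ k → Dec (A k)) → ℕ → ℕ
least A? zero = zero
least A? (suc b) with A? zero
... | yes _ = zero
... | no _ = suc (least (λ k → A? (suc k)) b)

least≤ : {A : ℕ → Set} (A? : ∀ k → Dec (A k)) (b : ℕ) → least A? b ≤ b
least≤ A? zero = z≤n
least≤ A? (suc b) with A? zero
... | yes _ = z≤n
... | no _ = s≤s (least≤ (λ k → A? (suc k)) b)

least-witness : {A : ℕ → Set} (A? : ∀ k → Dec (A k)) (b : ℕ) → least A? b < b → A (least A? b)
least-witness A? (suc b) lt with A? zero
... | yes a = a
... | no _ = least-witness (λ k → A? (suc k)) b (s≤s⁻¹ lt)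

least-minimal : {A : ℕ → Set} (A? : ∀ k → Dec (A k)) (b : ℕ) {k : ℕ} → A k → least A? b ≤ k
least-minimal A? zero a = z≤n
least-minimal A? (suc b) a with A? zero
least-minimal A? (suc b) a | yes _ = z≤n
least-minimal A? (suc b) {zero} a | no ¬a = ⊥-elim (¬a a)
least-minimal A? (suc b) {suc k} a | no _ = s≤s (least-minimal (λ k → A? (suc k)) b a)

𝟙 : Bool → ℕ
𝟙 true = 1
𝟙 false = 0

𝟙≤1 : ∀ b → 𝟙 b ≤ 1
𝟙≤1 true = ≤-refl
𝟙≤1 false = z≤n

𝟙-does-mono : ∀ {P Q : Set} (p? : Dec P) (q? : Dec Q) → (P → Q) → 𝟙 (does p?) ≤ 𝟙 (does q?)
𝟙-does-mono (yes _) (yes _) _ = ≤-refl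
𝟙-does-mono (yes p) (no ¬q) p⇒q = ⊥-elim (¬q (p⇒q p))
𝟙-does-mono (no _) _ _ = z≤n

T-nand₂ : ∀ {P Q : Set} (p? : Dec P) (q? : Dec Q) → (P → Q → ⊥) → T (not (does p? ∧ does q?))
T-nand₂ (yes p) (yes q) excluded = excluded p q
T-nand₂ (yes _) (no _) _ = tt
T-nand₂ (no _) _ _ = tt

T-nand₃ : ∀ {P Q R : Set} (p? : Dec P) (q? : Dec Q) (r? : Dec R) → (P → Q → R → ⊥) → T (not (does p? ∧ does q? ∧ does r?))
T-nand₃ (yes p) q? r? excluded = T-nand₂ q? r? (excluded p)
T-nand₃ (no _) _ _ _ = tt

T-nand₄ : ∀ {P Q R W : Set} (p? : Dec P) (q? : Dec Q) (r? : Dec R) (w? : Dec W) →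
          (P → Q → R → W → ⊥) → T (not (does p? ∧ does q? ∧ does r? ∧ does w?))
T-nand₄ (yes p) q? r? w? excluded = T-nand₃ q? r? w? (excluded p)
T-nand₄ (no _) _ _ _ _ = tt

_∧ᵀ_ : ∀ {x y} → T x → T y → T (x ∧ y)
_∧ᵀ_ {true} _ ty = ty
infixr 5 _∧ᵀ_

all-Bool? : {P : Bool → Set} → (∀ b → Dec (P b)) → Dec (∀ b → P b)
all-Bool? P? with P? true | P? false
... | yes p | yes q = yes λ { true → p ; false → q }
... | no ¬p | _ = no λ all → ¬p (all true)
... | yes _ | no ¬q = no λ all → ¬q (all false)

∑-mono-≤ : ∀ {k} {f g : Fin k → ℕ} → (∀ i → f i ≤ g i) → sum f ≤ sum g
∑-mono-≤ {zero} f≤g = z≤n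
∑-mono-≤ {suc k} f≤g = +-mono-≤ (f≤g Fin.zero) (∑-mono-≤ (f≤g ∘ Fin.suc))

∑-const : ∀ k c → ∑[ i < k ] c ≡ k * c
∑-const zero c = refl
∑-const (suc k) c = cong (c +_) (∑-const k c)

∑-+ : ∀ a b (g : ℕ → ℕ) → ∑[ i < a + b ] g (toℕ i) ≡ ∑[ i < a ] g (toℕ i) + ∑[ i < b ] g (a + toℕ i)
∑-+ zero b g = refl
∑-+ (suc a) b g = trans (cong (g 0 +_) (∑-+ a b (g ∘ suc))) (sym (+-assoc (g 0) _ _))

length-filterᵇ-tabulate : ∀ {A : Set} (p : A → Bool) {k} (f : Fin k → A) →
                          length (filterᵇ p (tabulate f)) ≡ ∑[ i < k ] 𝟙 (p (f i))
length-filterᵇ-tabulate p {zero} f = refl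
length-filterᵇ-tabulate p {suc k} f with p (f Fin.zero)
... | true = cong suc (length-filterᵇ-tabulate p (f ∘ Fin.suc))
... | false = length-filterᵇ-tabulate p (f ∘ Fin.suc)

quarter-bound : ∀ n t → 4 * t ≤ n * 5 → t ≤ n + n / 4
quarter-bound n t 4t≤5n = begin
  t              ≤⟨ m≤n+m∸n t n ⟩
  n + (t ∸ n)    ≤⟨ +-monoʳ-≤ n (begin
    t ∸ n             ≡⟨ m*n/n≡m (t ∸ n) 4 ⟨
    (t ∸ n) * 4 / 4   ≤⟨ /-monoˡ-≤ 4 excess*4≤n ⟩
    n / 4             ∎) ⟩
  n + n / 4      ∎
  where
  open ≤-Reasoning
  excess*4≤n : (t ∸ n) * 4 ≤ n
  excess*4≤n = begin
    (t ∸ n) * 4       ≡⟨ *-distribʳ-∸ 4 t n ⟩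
    t * 4 ∸ n * 4     ≤⟨ ∸-monoˡ-≤ (n * 4) (subst (_≤ n * 5) (*-comm 4 t) 4t≤5n) ⟩
    n * 5 ∸ n * 4     ≡⟨ cong (_∸ n * 4) (*-suc n 4) ⟩
    n + n * 4 ∸ n * 4 ≡⟨ m+n∸n≡m n (n * 4) ⟩
    n                 ∎

module _ {A : Set} (_≟_ : DecidableEquality A) where
  open import Data.List.Membership.DecPropositional _≟_ using (_∈?_)

  countIn : List A → List A → ℕ
  countIn xs [] = 0
  countIn xs (y ∷ ys) = 𝟙 (does (y ∈? xs)) + countIn xs ys

  countIn-++ : ∀ xs ys zs → countIn xs (ys ++ zs) ≡ countIn xs ys + countIn xs zs
  countIn-++ xs [] zs = refl
  countIn-++ xs (y ∷ ys) zs =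
    trans (cong (𝟙 (does (y ∈? xs)) +_) (countIn-++ xs ys zs)) (sym (+-assoc (𝟙 (does (y ∈? xs))) (countIn xs ys) (countIn xs zs)))

  countIn-mono : ∀ x xs ys → countIn xs ys ≤ countIn (x ∷ xs) ys
  countIn-mono x xs [] = z≤n
  countIn-mono x xs (y ∷ ys) = +-mono-≤ (𝟙-does-mono (y ∈? xs) (y ∈? (x ∷ xs)) there) (countIn-mono x xs ys)

  countIn-∷ : ∀ {x xs ys} → x ∉ xs → x ∈ ys → suc (countIn xs ys) ≤ countIn (x ∷ xs) ys
  countIn-∷ {x} {xs} {x ∷ ys} x∉xs (here refl) = begin
    suc (𝟙 (does (x ∈? xs)) + countIn xs ys)   ≡⟨ cong (λ k → suc (k + countIn xs ys)) (cong 𝟙 (dec-false (x ∈? xs) x∉xs)) ⟩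
    suc (countIn xs ys)                        ≤⟨ s≤s (countIn-mono x xs ys) ⟩
    suc (countIn (x ∷ xs) ys)                  ≡⟨ cong (_+ countIn (x ∷ xs) ys) (cong 𝟙 (dec-true (x ∈? (x ∷ xs)) (here refl))) ⟨
    countIn (x ∷ xs) (x ∷ ys)                  ∎
    where open ≤-Reasoning
  countIn-∷ {x} {xs} {y ∷ ys} x∉xs (there x∈ys) = begin
    suc (𝟙 (does (y ∈? xs)) + countIn xs ys)  ≡⟨ +-suc _ _ ⟨
    𝟙 (does (y ∈? xs)) + suc (countIn xs ys)  ≤⟨ +-mono-≤ (𝟙-does-mono (y ∈? xs) (y ∈? (x ∷ xs)) there) (countIn-∷ x∉xs x∈ys) ⟩
    countIn (x ∷ xs) (y ∷ ys)                 ∎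
    where open ≤-Reasoning

  countIn≤length : ∀ xs ys → countIn xs ys ≤ length ys
  countIn≤length xs [] = z≤n
  countIn≤length xs (y ∷ ys) = +-mono-≤ (𝟙≤1 (does (y ∈? xs))) (countIn≤length xs ys)

  countIn-tabulate : ∀ {k} xs (f : Fin k → A) → countIn xs (tabulate f) ≡ ∑[ i < k ] 𝟙 (does (f i ∈? xs))
  countIn-tabulate {zero} xs f = refl
  countIn-tabulate {suc k} xs f = cong (𝟙 (does (f Fin.zero ∈? xs)) +_) (countIn-tabulate xs (f ∘ Fin.suc))

  length≤countIn : ∀ {xs ys} → Unique xs → (∀ {x} → x ∈ xs → x ∈ ys) → length xs ≤ countIn xs ys
  length≤countIn {[]} _ _ = z≤n
  length≤countIn {x ∷ xs} unique@(_ AllPairs.∷ unique′) xs⊆ys =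
    ≤-trans (s≤s (length≤countIn unique′ (xs⊆ys ∘ there))) (countIn-∷ (Unique[x∷xs]⇒x∉xs unique) (xs⊆ys (here refl)))

module Rotation (m : ℕ) where

  n : ℕ
  n = suc m

  opaque
    next : Fin n → Fin n
    next i with suc (toℕ i) <? n
    ... | yes i+1<n = fromℕ< i+1<n
    ... | no _ = Fin.zero

    toℕ-next : ∀ i → toℕ (next i) ≡ suc (toℕ i) % n
    toℕ-next i with suc (toℕ i) <? n
    ... | yes i+1<n = trans (toℕ-fromℕ< i+1<n) (sym (m<n⇒m%n≡m i+1<n))
    ... | no i+1≮n = sym (trans (cong (_% n) i+1≡n) (n%n≡0 n))
      where
      i+1≡n : suc (toℕ i) ≡ n
      i+1≡n = ≤-antisym (toℕ<n i) (≮⇒≥ i+1≮n)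

  rotate : ℕ → Fin n → Fin n
  rotate zero x = x
  rotate (suc k) x = next (rotate k x)

  prev : Fin n → Fin n
  prev = rotate m

  toℕ-rotate : ∀ k x → toℕ (rotate k x) ≡ (toℕ x + k) % n
  toℕ-rotate zero x = sym (trans (cong (_% n) (+-identityʳ (toℕ x))) (m<n⇒m%n≡m (toℕ<n x)))
  toℕ-rotate (suc k) x = begin
    toℕ (next (rotate k x))      ≡⟨ toℕ-next (rotate k x) ⟩
    suc (toℕ (rotate k x)) % n   ≡⟨ cong (λ t → suc t % n) (toℕ-rotate k x) ⟩
    (1 + (toℕ x + k) % n) % n    ≡⟨ %-distribˡ-+ 1 ((toℕ x + k) % n) n ⟩
    (1 % n + (toℕ x + k) % n % n) % n ≡⟨ cong (λ t → (1 % n + t) % n) (m%n%n≡m%n (toℕ x + k) n) ⟩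
    (1 % n + (toℕ x + k) % n) % n ≡⟨ %-distribˡ-+ 1 (toℕ x + k) n ⟨
    (1 + (toℕ x + k)) % n        ≡⟨ cong (_% n) (sym (+-suc (toℕ x) k)) ⟩
    (toℕ x + suc k) % n          ∎
    where open ≡-Reasoning

  rotate-+ : ∀ a b x → rotate a (rotate b x) ≡ rotate (a + b) x
  rotate-+ zero b x = refl
  rotate-+ (suc a) b x = cong next (rotate-+ a b x)

  rotate-next : ∀ a x → rotate a (next x) ≡ next (rotate a x)
  rotate-next a x = trans (rotate-+ a 1 x) (cong (λ k → rotate k x) (+-comm a 1))

  rotate-period : ∀ x → rotate n x ≡ x
  rotate-period x = toℕ-injective (begin
    toℕ (rotate n x)  ≡⟨ toℕ-rotate n x ⟩
    (toℕ x + n) % n   ≡⟨ [m+n]%n≡m%n (toℕ x) n ⟩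
    toℕ x % n         ≡⟨ m<n⇒m%n≡m (toℕ<n x) ⟩
    toℕ x             ∎)
    where open ≡-Reasoning

  next-prev : ∀ x → next (prev x) ≡ x
  next-prev = rotate-period

  prev-next : ∀ x → prev (next x) ≡ x
  prev-next x = trans (rotate-next m x) (rotate-period x)

  next-injective : ∀ {x y} → next x ≡ next y → x ≡ y
  next-injective {x} {y} eq = begin
    x              ≡⟨ prev-next x ⟨
    prev (next x)  ≡⟨ cong prev eq ⟩
    prev (next y)  ≡⟨ prev-next y ⟩
    y              ∎
    where open ≡-Reasoning

  rotate-injective : ∀ k {x y} → rotate k x ≡ rotate k y → x ≡ y
  rotate-injective zero eq = eq
  rotate-injective (suc k) eq = rotate-injective k (next-injective eq)

  rotate-suc-prev : ∀ k x → rotate (suc k) (prev x) ≡ rotate k x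
  rotate-suc-prev k x = trans (sym (rotate-next k (prev x))) (cong (rotate k) (next-prev x))

  rotate-moves : ∀ d x → 0 < d → d < n → rotate d x ≢ x
  rotate-moves d x 0<d d<n eq = no-return (toℕ x + d <? n)
    where
    open ≡-Reasoning
    [x+d]%n≡x : (toℕ x + d) % n ≡ toℕ x
    [x+d]%n≡x = trans (sym (toℕ-rotate d x)) (cong toℕ eq)
    -- x + d wraps around n at most once.
    no-return : Dec (toℕ x + d < n) → ⊥
    no-return (yes x+d<n) = <⇒≢ (m<m+n (toℕ x) 0<d) (sym (trans (sym (m<n⇒m%n≡m x+d<n)) [x+d]%n≡x))
    no-return (no x+d≮n) = <⇒≢ d<n (+-cancelˡ-≡ (toℕ x) d n (begin
      toℕ x + d                    ≡⟨ m∸n+n≡m n≤x+d ⟨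
      (toℕ x + d ∸ n) + n          ≡⟨ cong (_+ n) (m<n⇒m%n≡m wrapped<n) ⟨
      (toℕ x + d ∸ n) % n + n      ≡⟨ cong (_+ n) (m≤n⇒[n∸m]%m≡n%m n≤x+d) ⟩
      (toℕ x + d) % n + n          ≡⟨ cong (_+ n) [x+d]%n≡x ⟩
      toℕ x + n                    ∎))
      where
      n≤x+d : n ≤ toℕ x + d
      n≤x+d = ≮⇒≥ x+d≮n
      wrapped<n : toℕ x + d ∸ n < n
      wrapped<n = +-cancelʳ-< n (toℕ x + d ∸ n) n
        (subst (_< n + n) (sym (m∸n+n≡m n≤x+d)) (+-mono-< (toℕ<n x) d<n))

  rotate-injectiveˡ : ∀ {p q} x → ∣ p - q ∣ < n → rotate p x ≡ rotate q x → p ≡ q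
  rotate-injectiveˡ {p} {q} x ∣p-q∣<n eq with <-cmp p q
  ... | tri≈ _ p≡q _ = p≡q
  ... | tri< p<q _ _ = ⊥-elim (rotate-moves (q ∸ p) (rotate p x) (m<n⇒0<n∸m p<q)
          (subst (_< n) (m≤n⇒∣m-n∣≡n∸m (<⇒≤ p<q)) ∣p-q∣<n)
          (trans (trans (rotate-+ (q ∸ p) p x) (cong (λ k → rotate k x) (m∸n+n≡m (<⇒≤ p<q)))) (sym eq)))
  ... | tri> _ _ q<p = ⊥-elim (rotate-moves (p ∸ q) (rotate q x) (m<n⇒0<n∸m q<p)
          (subst (_< n) (m≤n⇒∣n-m∣≡n∸m (<⇒≤ q<p)) ∣p-q∣<n)
          (trans (trans (rotate-+ (p ∸ q) q x) (cong (λ k → rotate k x) (m∸n+n≡m (<⇒≤ q<p)))) eq))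

  toℕ-next-< : ∀ i → suc (toℕ i) < n → toℕ (next i) ≡ suc (toℕ i)
  toℕ-next-< i lt = trans (toℕ-next i) (m<n⇒m%n≡m lt)

  toℕ-next-last : ∀ i → suc (toℕ i) ≡ n → toℕ (next i) ≡ 0
  toℕ-next-last i eq = trans (toℕ-next i) (trans (cong (_% n) eq) (n%n≡0 n))

  next-inject₁ : ∀ (i : Fin m) → next (Fin.inject₁ i) ≡ Fin.suc i
  next-inject₁ i = toℕ-injective (trans (toℕ-next-< (Fin.inject₁ i) (s≤s inject₁<m)) (cong suc (toℕ-inject₁ i)))
    where
    inject₁<m : toℕ (Fin.inject₁ i) < m
    inject₁<m = subst (_< m) (sym (toℕ-inject₁ i)) (toℕ<n i)

  next-fromℕ : next (Fin.fromℕ m) ≡ Fin.zero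
  next-fromℕ = toℕ-injective (toℕ-next-last (Fin.fromℕ m) (cong suc (toℕ-fromℕ m)))

  toℕ-prev : ∀ x {t} → toℕ x ≡ suc t → toℕ (prev x) ≡ t
  toℕ-prev x x≡ with m≤n⇒m<n∨m≡n (toℕ<n (prev x))
  ... | inj₁ lt = suc-injective (trans (sym (toℕ-next-< (prev x) lt)) (trans (cong toℕ (next-prev x)) x≡))
  ... | inj₂ eq = ⊥-elim (0≢1+n (trans (sym (toℕ-next-last (prev x) eq)) (trans (cong toℕ (next-prev x)) x≡)))

  CycleAdj⇒next : ∀ {i j} → CycleAdj n i j → j ≡ next i ⊎ i ≡ next j
  CycleAdj⇒next {i} {j} (inj₁ e) =
    inj₁ (toℕ-injective (sym (trans (toℕ-next-< i (subst (_< n) (sym e) (toℕ<n j))) e)))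
  CycleAdj⇒next {i} {j} (inj₂ (inj₁ e)) =
    inj₂ (toℕ-injective (sym (trans (toℕ-next-< j (subst (_< n) (sym e) (toℕ<n i))) e)))
  CycleAdj⇒next {i} {j} (inj₂ (inj₂ (inj₁ (i+1≡n , j≡0)))) =
    inj₁ (toℕ-injective (trans j≡0 (sym (toℕ-next-last i i+1≡n))))
  CycleAdj⇒next {i} {j} (inj₂ (inj₂ (inj₂ (j+1≡n , i≡0)))) =
    inj₂ (toℕ-injective (trans i≡0 (sym (toℕ-next-last j j+1≡n))))

  CycleAdj-sym : ∀ {i j} → CycleAdj n i j → CycleAdj n j i
  CycleAdj-sym (inj₁ e) = inj₂ (inj₁ e)
  CycleAdj-sym (inj₂ (inj₁ e)) = inj₁ e
  CycleAdj-sym (inj₂ (inj₂ (inj₁ e))) = inj₂ (inj₂ (inj₂ e))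
  CycleAdj-sym (inj₂ (inj₂ (inj₂ e))) = inj₂ (inj₂ (inj₁ e))

  CycleAdj-next : ∀ i → CycleAdj n i (next i)
  CycleAdj-next i with m≤n⇒m<n∨m≡n (toℕ<n i)
  ... | inj₁ i+1<n = inj₁ (sym (toℕ-next-< i i+1<n))
  ... | inj₂ i+1≡n = inj₂ (inj₂ (inj₁ (i+1≡n , toℕ-next-last i i+1≡n)))

  CycleAdj-prev : ∀ i → CycleAdj n (next i) i
  CycleAdj-prev i = CycleAdj-sym (CycleAdj-next i)

  next⇒CycleAdj : ∀ {i j} → j ≡ next i ⊎ i ≡ next j → CycleAdj n i j
  next⇒CycleAdj (inj₁ refl) = CycleAdj-next _
  next⇒CycleAdj (inj₂ refl) = CycleAdj-prev _

  CycleAdj-rotate⁻ : ∀ b a {j} → CycleAdj n (rotate (suc a) b) j → j ≡ rotate (suc (suc a)) b ⊎ j ≡ rotate a b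
  CycleAdj-rotate⁻ b a adj with CycleAdj⇒next adj
  ... | inj₁ j≡next = inj₁ j≡next
  ... | inj₂ next≡next = inj₂ (sym (next-injective next≡next))

  ∑-next : ∀ (f : Fin n → ℕ) → ∑[ i < n ] f (next i) ≡ sum f
  ∑-next f = begin
    ∑[ i < n ] f (next i)                              ≡⟨ sum-init-last (f ∘ next) ⟩
    ∑[ i < m ] f (next (Fin.inject₁ i)) + f (next (Fin.fromℕ m)) ≡⟨ cong₂ _+_ (sum-cong-≗ (cong f ∘ next-inject₁)) (cong f next-fromℕ) ⟩
    ∑[ i < m ] f (Fin.suc i) + f Fin.zero                ≡⟨ +-comm _ (f Fin.zero) ⟩
    sum f                                              ∎
    where open ≡-Reasoning

  potential-bound : ∀ (t Φ : Fin n → ℕ) K C → (∀ i → K * t i + Φ (next i) ≤ C + Φ i) → K * sum t ≤ n * C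
  potential-bound t Φ K C step = +-cancelʳ-≤ (sum Φ) (K * sum t) (n * C) (begin
    K * sum t + sum Φ                        ≡⟨ cong₂ _+_ (*-distribˡ-sum K t) (sym (∑-next Φ)) ⟩
    sum (λ i → K * t i) + ∑[ i < n ] Φ (next i) ≡⟨ ∑-distrib-+ (λ i → K * t i) (Φ ∘ next) ⟨
    ∑[ i < n ] (K * t i + Φ (next i))        ≤⟨ ∑-mono-≤ step ⟩
    ∑[ i < n ] (C + Φ i)                     ≡⟨ ∑-distrib-+ (λ _ → C) Φ ⟩
    ∑[ i < n ] C + sum Φ                     ≡⟨ cong (_+ sum Φ) (∑-const n C) ⟩
    n * C + sum Φ                            ∎)
    where open ≤-Reasoning

module CyclicDistance (m : ℕ) where
  open Rotation m

  Apart : ℕ → Fin n → Fin n → Set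
  Apart k i j = j ≡ rotate k i ⊎ i ≡ rotate k j

  Apart? : ∀ k i j → Dec (Apart k i j)
  Apart? k i j = (j ≟ᶠ rotate k i) ⊎-dec (i ≟ᶠ rotate k j)

  -- The cyclic distance truncated at 5; no larger distance matters in M(C_n).
  dist : Fin n → Fin n → ℕ
  dist i j = least (λ k → Apart? k i j) 5

  dist≤5 : ∀ i j → dist i j ≤ 5
  dist≤5 i j = least≤ (λ k → Apart? k i j) 5

  dist-apart : ∀ i j → dist i j < 5 → Apart (dist i j) i j
  dist-apart i j = least-witness (λ k → Apart? k i j) 5

  dist-minimal : ∀ {k i j} → Apart k i j → dist i j ≤ k
  dist-minimal {i = i} {j} = least-minimal (λ k → Apart? k i j) 5

  dist-refl : ∀ i → dist i i ≡ 0
  dist-refl i = n≤0⇒n≡0 (dist-minimal (inj₁ refl))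

  dist≡0⇒≡ : ∀ {i j} → dist i j ≡ 0 → i ≡ j
  dist≡0⇒≡ {i} {j} d≡0 with dist-apart i j (subst (_< 5) (sym d≡0) z<s)
  ... | apart rewrite d≡0 with apart
  ... | inj₁ j≡i = sym j≡i
  ... | inj₂ i≡j = i≡j

  apart-step : ∀ {k i i' j} → Apart k i' j → i' ≡ next i ⊎ i ≡ next i' → ∃[ k' ] k' ≤ suc k × Apart k' i j
  apart-step {k} {i} (inj₁ e) (inj₁ refl) = suc k , ≤-refl , inj₁ (trans e (rotate-next k i))
  apart-step {zero} (inj₂ e) (inj₁ refl) = 1 , ≤-refl , inj₁ (sym e)
  apart-step {suc k} (inj₂ e) (inj₁ refl) = k , m≤n⇒m≤1+n (n≤1+n k) , inj₂ (next-injective e)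
  apart-step {zero} (inj₁ e) (inj₂ e') = 1 , ≤-refl , inj₂ (trans e' (cong next (sym e)))
  apart-step {suc k} {i' = i'} (inj₁ e) (inj₂ refl) = k , m≤n⇒m≤1+n (n≤1+n k) , inj₁ (trans e (sym (rotate-next k i')))
  apart-step {k} (inj₂ e) (inj₂ refl) = suc k , ≤-refl , inj₂ (cong next e)

  dist-step : ∀ {i i'} j → i' ≡ next i ⊎ i ≡ next i' → dist i j ≤ suc (dist i' j)
  dist-step {i} {i'} j step with dist i' j <? 5
  ... | yes d<5 with apart-step (dist-apart i' j d<5) step
  ...   | k' , k'≤ , apart = ≤-trans (dist-minimal apart) k'≤
  dist-step {i} {i'} j step | no d≮5 = ≤-trans (dist≤5 i j) (m≤n⇒m≤1+n (≮⇒≥ d≮5))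

  AdjacentDists : ℕ → ℕ → Set
  AdjacentDists c c' = c ≤ suc c' × c' ≤ suc c × ¬ (c ≡ 0 × c' ≡ 0)

  dist-adjacent : 1 < n → ∀ {i i'} j → CycleAdj n i i' → AdjacentDists (dist i j) (dist i' j)
  dist-adjacent 1<n {i} {i'} j adj = dist-step j step , dist-step j (swap step) , not-both-zero
    where
    step = CycleAdj⇒next adj
    not-both-zero : ¬ (dist i j ≡ 0 × dist i' j ≡ 0)
    not-both-zero (d≡0 , d'≡0) with trans (dist≡0⇒≡ d≡0) (sym (dist≡0⇒≡ d'≡0)) | step
    ... | refl | inj₁ i≡next = rotate-moves 1 i z<s 1<n (sym i≡next)
    ... | refl | inj₂ i≡next = rotate-moves 1 i z<s 1<n (sym i≡next)

  apart-rotate⁻ : ∀ b a {c j} → Apart c (rotate a b) j → c ≤ a → j ≡ rotate (c + a) b ⊎ j ≡ rotate (a ∸ c) b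
  apart-rotate⁻ b a {c} (inj₁ j≡) _ = inj₁ (trans j≡ (rotate-+ c a b))
  apart-rotate⁻ b a {c} {j} (inj₂ ≡j) c≤a = inj₂ (rotate-injective c (begin
    rotate c j              ≡⟨ ≡j ⟨
    rotate a b              ≡⟨ cong (λ k → rotate k b) (m+[n∸m]≡n c≤a) ⟨
    rotate (c + (a ∸ c)) b  ≡⟨ rotate-+ c (a ∸ c) b ⟨
    rotate c (rotate (a ∸ c) b) ∎))
    where open ≡-Reasoning

  data DistCase (i j : Fin n) : Set where
    short : ∀ c → c < 4 → dist i j ≡ c → Apart c i j → DistCase i j
    long : 4 ≤ dist i j → DistCase i j

  dist-case : ∀ i j → DistCase i j
  dist-case i j with dist i j <? 4
  ... | yes d<4 = short (dist i j) d<4 refl (dist-apart i j (m≤n⇒m≤1+n d<4))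
  ... | no d≮4 = long (≮⇒≥ d≮4)

  dist-≥ : ∀ {i j d} → d ≤ 5 → (∀ {e} → e < d → ¬ Apart e i j) → d ≤ dist i j
  dist-≥ {i} {j} {d} d≤5 not-apart with d ≤? dist i j
  ... | yes d≤dist = d≤dist
  ... | no d≰dist = ⊥-elim (not-apart (≰⇒> d≰dist) (dist-apart i j (<-≤-trans (≰⇒> d≰dist) d≤5)))

  ∣c-[e+a]∣<n : ∀ a c {d e} → e < d → d + ∣ a - c ∣ ≤ n → ∣ c - (e + a) ∣ < n
  ∣c-[e+a]∣<n a c {d} {e} e<d bound = begin-strict
    ∣ c - (e + a) ∣              ≤⟨ ∣-∣-triangle c a (e + a) ⟩
    ∣ c - a ∣ + ∣ a - (e + a) ∣  ≡⟨ cong₂ _+_ (∣-∣-comm c a) (trans (cong (∣ a -_∣) (+-comm e a)) (∣m-m+n∣≡n a e)) ⟩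
    ∣ a - c ∣ + e                <⟨ +-monoʳ-< ∣ a - c ∣ e<d ⟩
    ∣ a - c ∣ + d                ≡⟨ +-comm ∣ a - c ∣ d ⟩
    d + ∣ a - c ∣                ≤⟨ bound ⟩
    n                            ∎
    where open ≤-Reasoning

  rotate-offset : ∀ b a c {e} → ∣ c - (e + a) ∣ < n → rotate c b ≡ rotate e (rotate a b) → ∣ a - c ∣ ≡ e
  rotate-offset b a c {e} close eq = begin
    ∣ a - c ∣        ≡⟨ cong (∣ a -_∣) (rotate-injectiveˡ b close (trans eq (rotate-+ e a b))) ⟩
    ∣ a - e + a ∣    ≡⟨ cong (∣ a -_∣) (+-comm e a) ⟩
    ∣ a - a + e ∣    ≡⟨ ∣m-m+n∣≡n a e ⟩
    e                ∎
    where open ≡-Reasoning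

  dist-rotate-≥ : ∀ b a c {d} → d ≤ 5 → d ≤ ∣ a - c ∣ → d + ∣ a - c ∣ ≤ n → d ≤ dist (rotate a b) (rotate c b)
  dist-rotate-≥ b a c {d} d≤5 d≤∣a-c∣ bound = dist-≥ d≤5 not-apart
    where
    not-apart : ∀ {e} → e < d → ¬ Apart e (rotate a b) (rotate c b)
    not-apart e<d (inj₁ eq) = <⇒≱ e<d (subst (d ≤_) (rotate-offset b a c (∣c-[e+a]∣<n a c e<d bound) eq) d≤∣a-c∣)
    not-apart e<d (inj₂ eq) = <⇒≱ e<d (subst (d ≤_) (trans (∣-∣-comm a c) (rotate-offset b c a (∣c-[e+a]∣<n c a e<d bound′) eq)) d≤∣a-c∣)
      where
      bound′ = subst (λ k → d + k ≤ n) (∣-∣-comm a c) bound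

module MycielskianOfCycle (m : ℕ) (1<n : 1 < suc m) where
  open Rotation m
  open CyclicDistance m

  M : Graph
  M = Mycielskian (Cycle n)

  pattern u i = inj₁ i
  pattern u′ i = inj₂ (inj₁ i)
  pattern v* = inj₂ (inj₂ tt)

  -- Distances in M(C_n) as functions of the cyclic distance c of the indices: from c = 4 on
  -- (c = 3 between u and u′) the route through v* is shortest, and d(u_i, u′_i) = 2.
  -- Only δ ≤ length is proved; the walks used below realise it.
  δuu δuu′ δu′u′ : ℕ → ℕ
  δuu 0 = 0
  δuu 1 = 1
  δuu 2 = 2
  δuu 3 = 3
  δuu _ = 4
  δuu′ 0 = 2
  δuu′ 1 = 1
  δuu′ 2 = 2
  δuu′ _ = 3
  δu′u′ 0 = 0
  δu′u′ _ = 2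

  δ : V M → V M → ℕ
  δ (u i) (u j) = δuu (dist i j)
  δ (u i) (u′ j) = δuu′ (dist i j)
  δ (u _) v* = 2
  δ (u′ i) (u j) = δuu′ (dist i j)
  δ (u′ i) (u′ j) = δu′u′ (dist i j)
  δ (u′ _) v* = 1
  δ v* (u _) = 2
  δ v* (u′ _) = 1
  δ v* v* = 0

  δuu≤ : ∀ c → δuu c ≤ c
  δuu≤ 0 = z≤n
  δuu≤ 1 = ≤-refl
  δuu≤ 2 = ≤-refl
  δuu≤ 3 = ≤-refl
  δuu≤ (suc (suc (suc (suc c)))) = s≤s (s≤s (s≤s (s≤s z≤n)))

  δuu≤4 : ∀ c → δuu c ≤ 4
  δuu≤4 0 = z≤n
  δuu≤4 1 = s≤s z≤n
  δuu≤4 2 = s≤s (s≤s z≤n)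
  δuu≤4 3 = s≤s (s≤s (s≤s z≤n))
  δuu≤4 (suc (suc (suc (suc c)))) = ≤-refl

  1≤δuu′ : ∀ c → 1 ≤ δuu′ c
  1≤δuu′ 0 = s≤s z≤n
  1≤δuu′ 1 = s≤s z≤n
  1≤δuu′ 2 = s≤s z≤n
  1≤δuu′ (suc (suc (suc c))) = s≤s z≤n

  δuu′≤3 : ∀ c → δuu′ c ≤ 3
  δuu′≤3 0 = s≤s (s≤s z≤n)
  δuu′≤3 1 = s≤s z≤n
  δuu′≤3 2 = s≤s (s≤s z≤n)
  δuu′≤3 (suc (suc (suc c))) = ≤-refl

  δu′u′≤2 : ∀ c → δu′u′ c ≤ 2
  δu′u′≤2 0 = z≤n
  δu′u′≤2 (suc c) = ≤-refl

  2≤δuu′ : ∀ {c} → 2 ≤ c → 2 ≤ δuu′ c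
  2≤δuu′ {2} _ = ≤-refl
  2≤δuu′ {suc (suc (suc c))} _ = s≤s (s≤s z≤n)
  2≤δuu′ {1} (s≤s ())

  3≤δuu′ : ∀ {c} → 3 ≤ c → 3 ≤ δuu′ c
  3≤δuu′ {suc (suc (suc c))} _ = ≤-refl
  3≤δuu′ {1} (s≤s ())
  3≤δuu′ {2} (s≤s (s≤s ()))

  3≤δuu : ∀ {c} → 3 ≤ c → 3 ≤ δuu c
  3≤δuu {3} _ = ≤-refl
  3≤δuu {suc (suc (suc (suc c)))} _ = s≤s (s≤s (s≤s z≤n))
  3≤δuu {1} (s≤s ())
  3≤δuu {2} (s≤s (s≤s ()))

  4≤δuu : ∀ {c} → 4 ≤ c → 4 ≤ δuu c
  4≤δuu {suc (suc (suc (suc c)))} _ = ≤-refl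
  4≤δuu {1} (s≤s ())
  4≤δuu {2} (s≤s (s≤s ()))
  4≤δuu {3} (s≤s (s≤s (s≤s ())))

  2≤δu′u′ : ∀ {c} → 1 ≤ c → 2 ≤ δu′u′ c
  2≤δu′u′ {suc c} _ = ≤-refl

  adjacent-to-0 : ∀ {c} → AdjacentDists c 0 → c ≡ 1
  adjacent-to-0 {0} (_ , _ , not-both) = ⊥-elim (not-both (refl , refl))
  adjacent-to-0 {1} _ = refl
  adjacent-to-0 {suc (suc c)} (s≤s () , _)

  δuu-step : ∀ c c' → AdjacentDists c c' → δuu c ≤ suc (δuu c')
  δuu-step c 0 (c≤ , _) = ≤-trans (δuu≤ c) c≤
  δuu-step c 1 (c≤ , _) = ≤-trans (δuu≤ c) c≤
  δuu-step c 2 (c≤ , _) = ≤-trans (δuu≤ c) c≤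
  δuu-step c 3 (c≤ , _) = ≤-trans (δuu≤ c) c≤
  δuu-step c (suc (suc (suc (suc c')))) _ = m≤n⇒m≤1+n (δuu≤4 c)

  δuu′-step : ∀ c c' → AdjacentDists c c' → δuu′ c ≤ suc (δuu′ c')
  δuu′-step c 0 adj rewrite adjacent-to-0 adj = s≤s z≤n
  δuu′-step 0 1 _ = ≤-refl
  δuu′-step 1 1 _ = s≤s z≤n
  δuu′-step 2 1 _ = ≤-refl
  δuu′-step (suc (suc (suc c))) 1 (s≤s (s≤s ()) , _)
  δuu′-step c 2 _ = δuu′≤3 c
  δuu′-step c (suc (suc (suc c'))) _ = m≤n⇒m≤1+n (δuu′≤3 c)

  δuu-step-δuu′ : ∀ c c' → AdjacentDists c c' → δuu c ≤ suc (δuu′ c')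
  δuu-step-δuu′ c 0 (c≤ , _) = ≤-trans (δuu≤ c) (≤-trans c≤ (s≤s z≤n))
  δuu-step-δuu′ c 1 (c≤ , _) = ≤-trans (δuu≤ c) c≤
  δuu-step-δuu′ c 2 (c≤ , _) = ≤-trans (δuu≤ c) c≤
  δuu-step-δuu′ c (suc (suc (suc c'))) _ = δuu≤4 c

  δuu′-step-δuu : ∀ c c' → AdjacentDists c c' → δuu′ c ≤ suc (δuu c')
  δuu′-step-δuu c 0 adj rewrite adjacent-to-0 adj = ≤-refl
  δuu′-step-δuu 0 1 _ = ≤-refl
  δuu′-step-δuu 1 1 _ = s≤s z≤n
  δuu′-step-δuu 2 1 _ = ≤-refl
  δuu′-step-δuu (suc (suc (suc c))) 1 (s≤s (s≤s ()) , _)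
  δuu′-step-δuu c 2 _ = δuu′≤3 c
  δuu′-step-δuu c (suc (suc (suc c'))) _ = ≤-trans (δuu′≤3 c) (m≤n⇒m≤1+n (3≤δuu (s≤s (s≤s (s≤s z≤n)))))

  δuu′-step-δu′u′ : ∀ c c' → AdjacentDists c c' → δuu′ c ≤ suc (δu′u′ c')
  δuu′-step-δu′u′ c 0 adj rewrite adjacent-to-0 adj = ≤-refl
  δuu′-step-δu′u′ c (suc c') _ = δuu′≤3 c

  δ-edge : ∀ x z y → Adj M x z → δ x y ≤ suc (δ z y)
  δ-edge (u i) (u i') (u j) adj = δuu-step _ _ (dist-adjacent 1<n j adj)
  δ-edge (u i) (u i') (u′ j) adj = δuu′-step _ _ (dist-adjacent 1<n j adj)
  δ-edge (u i) (u i') v* adj = s≤s (s≤s z≤n)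
  δ-edge (u i) (u′ i') (u j) adj = δuu-step-δuu′ _ _ (dist-adjacent 1<n j adj)
  δ-edge (u i) (u′ i') (u′ j) adj = δuu′-step-δu′u′ _ _ (dist-adjacent 1<n j adj)
  δ-edge (u i) (u′ i') v* adj = ≤-refl
  δ-edge (u′ i) (u i') (u j) adj = δuu′-step-δuu _ _ (dist-adjacent 1<n j adj)
  δ-edge (u′ i) (u i') (u′ j) adj = ≤-trans (δu′u′≤2 (dist i j)) (s≤s (1≤δuu′ (dist i' j)))
  δ-edge (u′ i) (u i') v* adj = s≤s z≤n
  δ-edge (u′ i) v* (u j) adj = δuu′≤3 (dist i j)
  δ-edge (u′ i) v* (u′ j) adj = δu′u′≤2 (dist i j)
  δ-edge (u′ i) v* v* adj = s≤s z≤n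
  δ-edge v* (u′ i') (u j) adj = s≤s (1≤δuu′ (dist i' j))
  δ-edge v* (u′ i') (u′ j) adj = s≤s z≤n
  δ-edge v* (u′ i') v* adj = z≤n

  δ-refl : ∀ x → δ x x ≡ 0
  δ-refl (u i) rewrite dist-refl i = refl
  δ-refl (u′ i) rewrite dist-refl i = refl
  δ-refl v* = refl

  δ≤length : ∀ {x y k} → Walk M x y k → δ x y ≤ k
  δ≤length {x} nil = ≤-reflexive (δ-refl x)
  δ≤length {x} {y} (cons {z = z} adj w) = ≤-trans (δ-edge x z y adj) (s≤s (δ≤length w))

  walk-shorter-than-δ : ∀ {x y k} → Walk M x y k → k < δ x y → ⊥
  walk-shorter-than-δ w k<δ = <⇒≱ k<δ (δ≤length w)

  module _ (S : List (V M)) where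

    visible-via : ∀ {x y k} (w : Walk M x y k) → k ≤ δ x y → All (_∉ S) (interior M w) → Visible M S x y
    visible-via {k = k} w k≤δ avoids = k , w , (λ k' w' → ≤-trans k≤δ (δ≤length w')) , avoids

    visible-refl : ∀ {x} → Visible M S x x
    visible-refl = 0 , nil , (λ _ _ → z≤n) , []

    visible-edge : ∀ {x y} → Adj M x y → 1 ≤ δ x y → Visible M S x y
    visible-edge e 1≤δ = visible-via (cons e nil) 1≤δ []

    visible-through₁ : ∀ {x z y} → Adj M x z → Adj M z y → z ∉ S → 2 ≤ δ x y → Visible M S x y
    visible-through₁ e₁ e₂ z∉S 2≤δ = visible-via (cons e₁ (cons e₂ nil)) 2≤δ (z∉S ∷ [])

    visible-through₂ : ∀ {x z₁ z₂ y} → Adj M x z₁ → Adj M z₁ z₂ → Adj M z₂ y → z₁ ∉ S → z₂ ∉ S → 3 ≤ δ x y →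
                       Visible M S x y
    visible-through₂ e₁ e₂ e₃ z₁∉S z₂∉S 3≤δ = visible-via (cons e₁ (cons e₂ (cons e₃ nil))) 3≤δ (z₁∉S ∷ z₂∉S ∷ [])

    visible-through₃ : ∀ {x z₁ z₂ z₃ y} → Adj M x z₁ → Adj M z₁ z₂ → Adj M z₂ z₃ → Adj M z₃ y →
                       z₁ ∉ S → z₂ ∉ S → z₃ ∉ S → 4 ≤ δ x y → Visible M S x y
    visible-through₃ e₁ e₂ e₃ e₄ z₁∉S z₂∉S z₃∉S 4≤δ =
      visible-via (cons e₁ (cons e₂ (cons e₃ (cons e₄ nil)))) 4≤δ (z₁∉S ∷ z₂∉S ∷ z₃∉S ∷ [])

    avoiding-walk : ∀ {x y} L → Visible M S x y → Walk M x y L → L ≤ δ x y →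
                    Σ (Walk M x y L) (λ w → All (_∉ S) (interior M w))
    avoiding-walk L (k , w , shortest , avoids) w₀ L≤δ with ≤-antisym (shortest L w₀) (≤-trans L≤δ (δ≤length w))
    ... | refl = w , avoids

module ForbiddenConfigurations (m : ℕ) (8≤n : 8 ≤ suc m) where
  open Rotation m
  open CyclicDistance m
  open MycielskianOfCycle m (≤-trans (s≤s (s≤s z≤n)) 8≤n)

  -- Each configuration, placed at offsets from a base b, is refuted by showing that every shortest walk
  -- between two of its vertices has an inner vertex in it.
  module _ {S : List (V M)} (mv : IsMutualVisibilitySet M S) (b : Fin n) where

    private
      ⟨_⟩ : ℕ → Fin n
      ⟨ a ⟩ = rotate a b

      dist⟨⟩-≥ : ∀ a c {d} {_ : True (d ≤? 5)} {_ : True (d ≤? ∣ a - c ∣)} {_ : True (d + ∣ a - c ∣ ≤? 8)} →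
                 d ≤ dist ⟨ a ⟩ ⟨ c ⟩
      dist⟨⟩-≥ a c {_} {d≤5} {d≤∣a-c∣} {bound} =
        dist-rotate-≥ b a c (toWitness d≤5) (toWitness d≤∣a-c∣) (≤-trans (toWitness bound) 8≤n)

      u-neighbour : ∀ a z → Adj M (u ⟨ suc a ⟩) z →
                    z ≡ u ⟨ 2 + a ⟩ ⊎ z ≡ u ⟨ a ⟩ ⊎ z ≡ u′ ⟨ 2 + a ⟩ ⊎ z ≡ u′ ⟨ a ⟩
      u-neighbour a (u j) adj with CycleAdj-rotate⁻ b a adj
      ... | inj₁ refl = inj₁ refl
      ... | inj₂ refl = inj₂ (inj₁ refl)
      u-neighbour a (u′ j) adj with CycleAdj-rotate⁻ b a adj
      ... | inj₁ refl = inj₂ (inj₂ (inj₁ refl))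
      ... | inj₂ refl = inj₂ (inj₂ (inj₂ refl))

      u′-neighbour : ∀ a z → Adj M (u′ ⟨ suc a ⟩) z → z ≡ u ⟨ 2 + a ⟩ ⊎ z ≡ u ⟨ a ⟩ ⊎ z ≡ v*
      u′-neighbour a (u j) adj with CycleAdj-rotate⁻ b a adj
      ... | inj₁ refl = inj₁ refl
      ... | inj₂ refl = inj₂ (inj₁ refl)
      u′-neighbour a v* adj = inj₂ (inj₂ refl)

    ¬u₁u₂u′₃ : u ⟨ 1 ⟩ ∈ S → u ⟨ 2 ⟩ ∈ S → u′ ⟨ 3 ⟩ ∈ S → ⊥
    ¬u₁u₂u′₃ u₁ u₂ u′₃
      with avoiding-walk S 2 (mv _ _ u₁ u′₃)
             (cons {z = u ⟨ 2 ⟩} (CycleAdj-next ⟨ 1 ⟩) (cons (CycleAdj-next ⟨ 2 ⟩) nil)) (2≤δuu′ (dist⟨⟩-≥ 1 3))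
    ... | cons {z = z} adj w@(cons _ _) , z∉S ∷ _ with u-neighbour 0 z adj
    ...   | inj₁ refl = z∉S u₂
    ...   | inj₂ (inj₁ refl) = walk-shorter-than-δ w (2≤δuu′ (dist⟨⟩-≥ 0 3))
    ...   | inj₂ (inj₂ (inj₁ refl)) = walk-shorter-than-δ w (2≤δu′u′ (dist⟨⟩-≥ 2 3))
    ...   | inj₂ (inj₂ (inj₂ refl)) = walk-shorter-than-δ w (2≤δu′u′ (dist⟨⟩-≥ 0 3))

    ¬u′₁u₂u₃ : u′ ⟨ 1 ⟩ ∈ S → u ⟨ 2 ⟩ ∈ S → u ⟨ 3 ⟩ ∈ S → ⊥
    ¬u′₁u₂u₃ u′₁ u₂ u₃
      with avoiding-walk S 2 (mv _ _ u₃ u′₁)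
             (cons {z = u ⟨ 2 ⟩} (CycleAdj-prev ⟨ 2 ⟩) (cons (CycleAdj-prev ⟨ 1 ⟩) nil)) (2≤δuu′ (dist⟨⟩-≥ 3 1))
    ... | cons {z = z} adj w@(cons _ _) , z∉S ∷ _ with u-neighbour 2 z adj
    ...   | inj₁ refl = walk-shorter-than-δ w (2≤δuu′ (dist⟨⟩-≥ 4 1))
    ...   | inj₂ (inj₁ refl) = z∉S u₂
    ...   | inj₂ (inj₂ (inj₁ refl)) = walk-shorter-than-δ w (2≤δu′u′ (dist⟨⟩-≥ 4 1))
    ...   | inj₂ (inj₂ (inj₂ refl)) = walk-shorter-than-δ w (2≤δu′u′ (dist⟨⟩-≥ 2 1))

    ¬u₁u₂u′₂u₄ : u ⟨ 1 ⟩ ∈ S → u ⟨ 2 ⟩ ∈ S → u′ ⟨ 2 ⟩ ∈ S → u ⟨ 4 ⟩ ∈ S → ⊥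
    ¬u₁u₂u′₂u₄ u₁ u₂ u′₂ u₄
      with avoiding-walk S 3 (mv _ _ u₁ u₄)
             (cons {z = u ⟨ 2 ⟩} (CycleAdj-next ⟨ 1 ⟩) (cons {z = u ⟨ 3 ⟩} (CycleAdj-next ⟨ 2 ⟩)
               (cons (CycleAdj-next ⟨ 3 ⟩) nil))) (3≤δuu (dist⟨⟩-≥ 1 4))
    ... | cons {z = z} adj w@(cons _ _) , z∉S ∷ _ with u-neighbour 0 z adj
    ...   | inj₁ refl = z∉S u₂
    ...   | inj₂ (inj₁ refl) = walk-shorter-than-δ w (3≤δuu (dist⟨⟩-≥ 0 4))
    ...   | inj₂ (inj₂ (inj₁ refl)) = z∉S u′₂
    ...   | inj₂ (inj₂ (inj₂ refl)) = walk-shorter-than-δ w (3≤δuu′ (dist⟨⟩-≥ 0 4))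

    ¬u′₁u₂u′₃u₄u′₅ : u′ ⟨ 1 ⟩ ∈ S → u ⟨ 2 ⟩ ∈ S → u′ ⟨ 3 ⟩ ∈ S → u ⟨ 4 ⟩ ∈ S → u′ ⟨ 5 ⟩ ∈ S → ⊥
    ¬u′₁u₂u′₃u₄u′₅ u′₁ u₂ u′₃ u₄ u′₅
      with avoiding-walk S 3 (mv _ _ u₂ u′₅)
             (cons {z = u′ ⟨ 3 ⟩} (CycleAdj-next ⟨ 2 ⟩) (cons {z = v*} tt (cons tt nil))) (3≤δuu′ (dist⟨⟩-≥ 2 5))
    ... | cons {z = z} adj w@(cons _ _) , z∉S ∷ _ with u-neighbour 1 z adj
    ...   | inj₂ (inj₁ refl) = walk-shorter-than-δ w (3≤δuu′ (dist⟨⟩-≥ 1 5))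
    ...   | inj₂ (inj₂ (inj₁ refl)) = z∉S u′₃
    ...   | inj₂ (inj₂ (inj₂ refl)) = z∉S u′₁
    ¬u′₁u₂u′₃u₄u′₅ u′₁ u₂ u′₃ u₄ u′₅ | cons adj (cons {z = z′} adj′ w′@(cons _ _)) , _ ∷ z′∉S ∷ _ | inj₁ refl
      with u-neighbour 2 z′ adj′
    ...   | inj₁ refl = z′∉S u₄
    ...   | inj₂ (inj₁ refl) = walk-shorter-than-δ w′ (2≤δuu′ (dist⟨⟩-≥ 2 5))
    ...   | inj₂ (inj₂ (inj₁ refl)) = walk-shorter-than-δ w′ (2≤δu′u′ (dist⟨⟩-≥ 4 5))
    ...   | inj₂ (inj₂ (inj₂ refl)) = walk-shorter-than-δ w′ (2≤δu′u′ (dist⟨⟩-≥ 2 5))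

    v*∈S⇒¬u′₁u′₂ : v* ∈ S → u′ ⟨ 1 ⟩ ∈ S → u′ ⟨ 2 ⟩ ∈ S → ⊥
    v*∈S⇒¬u′₁u′₂ v*∈S u′₁ u′₂
      with avoiding-walk S 2 (mv _ _ u′₁ u′₂) (cons {z = v*} tt (cons tt nil)) (2≤δu′u′ (dist⟨⟩-≥ 1 2))
    ... | cons {z = z} adj w@(cons _ _) , z∉S ∷ _ with u′-neighbour 0 z adj
    ...   | inj₁ refl = walk-shorter-than-δ w (≤-reflexive (cong δuu′ (sym (dist-refl ⟨ 2 ⟩))))
    ...   | inj₂ (inj₁ refl) = walk-shorter-than-δ w (2≤δuu′ (dist⟨⟩-≥ 0 2))
    ...   | inj₂ (inj₂ refl) = z∉S v*∈S

    closed⇒u-near : u′ ⟨ 1 ⟩ ∈ S → u ⟨ 2 ⟩ ∈ S → u′ ⟨ 3 ⟩ ∈ S → ∀ {j} → u j ∈ S → dist ⟨ 2 ⟩ j < 5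
    closed⇒u-near u′₁ u₂ u′₃ {j} uj with dist ⟨ 2 ⟩ j <? 5
    ... | yes d<5 = d<5
    ... | no d≮5 = ⊥-elim (impossible (≮⇒≥ d≮5))
      where
      impossible : 5 ≤ dist ⟨ 2 ⟩ j → ⊥
      impossible 5≤d
        with avoiding-walk S 4 (mv _ _ u₂ uj)
               (cons {z = u′ ⟨ 3 ⟩} (CycleAdj-next ⟨ 2 ⟩) (cons {z = v*} tt
                 (cons {z = u′ (next j)} tt (cons (CycleAdj-prev j) nil)))) (4≤δuu (≤-trans (n≤1+n 4) 5≤d))
      ... | cons {z = z} adj w@(cons _ _) , z∉S ∷ _ with u-neighbour 1 z adj
      ...   | inj₁ refl = walk-shorter-than-δ w (4≤δuu (s≤s⁻¹ (≤-trans 5≤d (dist-step j (inj₁ refl)))))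
      ...   | inj₂ (inj₁ refl) = walk-shorter-than-δ w (4≤δuu (s≤s⁻¹ (≤-trans 5≤d (dist-step j (inj₂ refl)))))
      ...   | inj₂ (inj₂ (inj₁ refl)) = z∉S u′₃
      ...   | inj₂ (inj₂ (inj₂ refl)) = z∉S u′₁

    closed⇒u′-near : u′ ⟨ 1 ⟩ ∈ S → u ⟨ 2 ⟩ ∈ S → u′ ⟨ 3 ⟩ ∈ S → ∀ {j} → u′ j ∈ S → dist ⟨ 2 ⟩ j < 4
    closed⇒u′-near u′₁ u₂ u′₃ {j} u′j with dist ⟨ 2 ⟩ j <? 4
    ... | yes d<4 = d<4
    ... | no d≮4 = ⊥-elim (impossible (≮⇒≥ d≮4))
      where
      impossible : 4 ≤ dist ⟨ 2 ⟩ j → ⊥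
      impossible 4≤d
        with avoiding-walk S 3 (mv _ _ u₂ u′j)
               (cons {z = u′ ⟨ 3 ⟩} (CycleAdj-next ⟨ 2 ⟩) (cons {z = v*} tt (cons tt nil))) (3≤δuu′ (≤-trans (n≤1+n 3) 4≤d))
      ... | cons {z = z} adj w@(cons _ _) , z∉S ∷ _ with u-neighbour 1 z adj
      ...   | inj₁ refl = walk-shorter-than-δ w (3≤δuu′ (s≤s⁻¹ (≤-trans 4≤d (dist-step j (inj₁ refl)))))
      ...   | inj₂ (inj₁ refl) = walk-shorter-than-δ w (3≤δuu′ (s≤s⁻¹ (≤-trans 4≤d (dist-step j (inj₂ refl)))))
      ...   | inj₂ (inj₂ (inj₁ refl)) = z∉S u′₃
      ...   | inj₂ (inj₂ (inj₂ refl)) = z∉S u′₁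

Occupancy : Set
Occupancy = Bool × Bool

pattern empty = false , false
pattern onlyU = true , false
pattern onlyU′ = false , true
pattern both = true , true

size : Occupancy → ℕ
size (a , b) = 𝟙 a + 𝟙 b

all-Occupancy? : {P : Occupancy → Set} → (∀ s → Dec (P s)) → Dec (∀ s → P s)
all-Occupancy? P? = map′ (λ all (a , b) → all a b) (λ all a b → all (a , b)) (all-Bool? λ a → all-Bool? λ b → P? (a , b))

admissible₁ : Occupancy → Occupancy → Occupancy → Occupancy → Bool
admissible₁ (a₀ , b₀) (a₁ , b₁) (a₂ , b₂) (a₃ , b₃) =
  not (b₀ ∧ a₁ ∧ b₂) ∧ not (b₁ ∧ a₂ ∧ b₃) ∧ not (a₀ ∧ a₁ ∧ b₂) ∧ not (a₁ ∧ a₂ ∧ b₃) ∧ not (a₀ ∧ a₁ ∧ b₁ ∧ a₃)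

-- The potentials φ₁, φ₂ are shortest-path potentials in the graph of admissible windows
-- (values on non-admissible windows are arbitrary).
φ₁ : Occupancy → Occupancy → Occupancy → ℕ
φ₁ empty  both   onlyU′ = 1
φ₁ empty  both   both   = 1
φ₁ onlyU′ onlyU′ onlyU′ = 1
φ₁ onlyU′ onlyU′ both   = 2
φ₁ onlyU′ both   empty  = 3
φ₁ onlyU′ both   onlyU  = 2
φ₁ onlyU  onlyU′ onlyU′ = 1
φ₁ onlyU  onlyU′ both   = 2
φ₁ onlyU  both   _      = 2
φ₁ both   empty  both   = 4
φ₁ both   onlyU′ onlyU′ = 5
φ₁ both   onlyU′ both   = 6
φ₁ both   both   _      = 6
φ₁ both   _      _      = 3
φ₁ _      _      _      = 0

potential₁-step : ∀ s₀ s₁ s₂ s₃ → T (admissible₁ s₀ s₁ s₂ s₃) → 4 * size s₀ + φ₁ s₁ s₂ s₃ ≤ 5 + φ₁ s₀ s₁ s₂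
potential₁-step = toWitness {a? = all-Occupancy? λ s₀ → all-Occupancy? λ s₁ → all-Occupancy? λ s₂ → all-Occupancy? λ s₃ →
                    T? (admissible₁ s₀ s₁ s₂ s₃) →-dec (4 * size s₀ + φ₁ s₁ s₂ s₃ ≤? 5 + φ₁ s₀ s₁ s₂)} tt

admissible₂ : Occupancy → Occupancy → Occupancy → Bool
admissible₂ (a₀ , b₀) (a₁ , b₁) (a₂ , b₂) =
  not (b₀ ∧ b₁) ∧ not (b₁ ∧ b₂) ∧ not (a₀ ∧ a₁ ∧ b₂) ∧ not (b₀ ∧ a₁ ∧ a₂)

φ₂ : Occupancy → Occupancy → ℕ
φ₂ onlyU both  = 1
φ₂ both  empty = 1
φ₂ both  onlyU = 1
φ₂ _     _     = 0

potential₂-step : ∀ s₀ s₁ s₂ → T (admissible₂ s₀ s₁ s₂) → 1 * size s₀ + φ₂ s₁ s₂ ≤ 1 + φ₂ s₀ s₁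
potential₂-step = toWitness {a? = all-Occupancy? λ s₀ → all-Occupancy? λ s₁ → all-Occupancy? λ s₂ →
                    T? (admissible₂ s₀ s₁ s₂) →-dec (1 * size s₀ + φ₂ s₁ s₂ ≤? 1 + φ₂ s₀ s₁)} tt

group-bound : ∀ p q r s t → T (not (p ∧ q) ∧ not (p ∧ s) ∧ not (q ∧ r ∧ t)) →
              𝟙 p + (𝟙 q + (𝟙 r + (𝟙 s + (𝟙 t + 0)))) ≤ 3
group-bound = toWitness {a? = all-Bool? λ p → all-Bool? λ q → all-Bool? λ r → all-Bool? λ s → all-Bool? λ t →
                T? (not (p ∧ q) ∧ not (p ∧ s) ∧ not (q ∧ r ∧ t)) →-dec (𝟙 p + (𝟙 q + (𝟙 r + (𝟙 s + (𝟙 t + 0)))) ≤? 3)} tt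

module UpperBound (m : ℕ) (8≤n : 8 ≤ suc m) where
  open Rotation m
  open CyclicDistance m
  open MycielskianOfCycle m (≤-trans (s≤s (s≤s z≤n)) 8≤n)
  open ForbiddenConfigurations m 8≤n

  _≟ᵛ_ : DecidableEquality (V M)
  _≟ᵛ_ = ≡-dec _≟ᶠ_ (≡-dec _≟ᶠ_ _≟ᵗ_)

  open import Data.List.Membership.DecPropositional _≟ᵛ_ using (_∈?_)

  open import Data.List.Membership.DecPropositional (×-≡-dec _≟ᵇ_ _≟_) using () renaming (_∈?_ to _∈?ˢ_)

  _∈ᵇ_ : V M → List (V M) → Bool
  x ∈ᵇ S = does (x ∈? S)

  vertices : List (V M)
  vertices = tabulate u ++ tabulate u′ ++ v* ∷ []

  ∈-vertices : ∀ x → x ∈ vertices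
  ∈-vertices (u i) = ∈-++⁺ˡ (∈-tabulate⁺ {f = u} i)
  ∈-vertices (u′ i) = ∈-++⁺ʳ (tabulate u) (∈-++⁺ˡ (∈-tabulate⁺ {f = u′} i))
  ∈-vertices v* = ∈-++⁺ʳ (tabulate u) (∈-++⁺ʳ (tabulate u′) (here refl))

  module _ (S : List (V M)) where

    occupancy : Fin n → Occupancy
    occupancy i = u i ∈ᵇ S , u′ i ∈ᵇ S

    length≤∑size : Unique S → length S ≤ ∑[ i < n ] size (occupancy i) + 𝟙 (v* ∈ᵇ S)
    length≤∑size unique = begin
      length S                 ≤⟨ length≤countIn _≟ᵛ_ unique (λ {x} _ → ∈-vertices x) ⟩
      countIn _≟ᵛ_ S vertices  ≡⟨ countIn-++ _≟ᵛ_ S (tabulate u) _ ⟩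
      #u + countIn _≟ᵛ_ S (tabulate u′ ++ v* ∷ [])  ≡⟨ cong (#u +_) (countIn-++ _≟ᵛ_ S (tabulate u′) _) ⟩
      #u + (#u′ + (#v* + 0))   ≡⟨ cong (λ k → #u + (#u′ + k)) (+-identityʳ #v*) ⟩
      #u + (#u′ + #v*)         ≡⟨ +-assoc #u #u′ #v* ⟨
      #u + #u′ + #v*           ≡⟨ cong₂ (λ a b → a + b + #v*) (countIn-tabulate _≟ᵛ_ S u) (countIn-tabulate _≟ᵛ_ S u′) ⟩
      ∑[ i < n ] 𝟙 (u i ∈ᵇ S) + ∑[ i < n ] 𝟙 (u′ i ∈ᵇ S) + #v*
                               ≡⟨ cong (_+ #v*) (∑-distrib-+ (λ i → 𝟙 (u i ∈ᵇ S)) (λ i → 𝟙 (u′ i ∈ᵇ S))) ⟨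
      ∑[ i < n ] size (occupancy i) + #v* ∎
      where
      open ≤-Reasoning
      #u = countIn _≟ᵛ_ S (tabulate u)
      #u′ = countIn _≟ᵛ_ S (tabulate u′)
      #v* = 𝟙 (v* ∈ᵇ S)

    Closed : Fin n → Set
    Closed i = u′ i ∈ S × u (next i) ∈ S × u′ (next (next i)) ∈ S

    closed? : ∀ i → Dec (Closed i)
    closed? i = (u′ i ∈? S) ×-dec (u (next i) ∈? S) ×-dec (u′ (next (next i)) ∈? S)

    from-prev : ∀ i (f : Fin n → V M) k → f (rotate k i) ∈ S → f (rotate (suc k) (prev i)) ∈ S
    from-prev i f k = subst (λ j → f j ∈ S) (sym (rotate-suc-prev k i))

    excluded₂ : ∀ x y → (x ∈ S → y ∈ S → ⊥) → T (not (x ∈ᵇ S ∧ y ∈ᵇ S))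
    excluded₂ x y = T-nand₂ (x ∈? S) (y ∈? S)

    excluded₃ : ∀ x y z → (x ∈ S → y ∈ S → z ∈ S → ⊥) → T (not (x ∈ᵇ S ∧ y ∈ᵇ S ∧ z ∈ᵇ S))
    excluded₃ x y z = T-nand₃ (x ∈? S) (y ∈? S) (z ∈? S)

    excluded₄ : ∀ x y z w → (x ∈ S → y ∈ S → z ∈ S → w ∈ S → ⊥) →
                T (not (x ∈ᵇ S ∧ y ∈ᵇ S ∧ z ∈ᵇ S ∧ w ∈ᵇ S))
    excluded₄ x y z w = T-nand₄ (x ∈? S) (y ∈? S) (z ∈? S) (w ∈? S)

    module _ (mv : IsMutualVisibilitySet M S) where

      admissible₁-at : (∀ i → ¬ Closed i) → ∀ i →
        T (admissible₁ (occupancy i) (occupancy (next i)) (occupancy (rotate 2 i)) (occupancy (rotate 3 i)))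
      admissible₁-at no-closed i =
        excluded₃ (u′ i) (u i₁) (u′ i₂) (λ a b c → no-closed i (a , b , c)) ∧ᵀ
        excluded₃ (u′ i₁) (u i₂) (u′ i₃) (λ a b c → no-closed i₁ (a , b , c)) ∧ᵀ
        excluded₃ (u i) (u i₁) (u′ i₂) (λ a b c → ¬u₁u₂u′₃ mv (prev i) (shift u 0 a) (shift u 1 b) (shift u′ 2 c)) ∧ᵀ
        excluded₃ (u i₁) (u i₂) (u′ i₃) (¬u₁u₂u′₃ mv i) ∧ᵀ
        excluded₄ (u i) (u i₁) (u′ i₁) (u i₃) (λ a b c d → ¬u₁u₂u′₂u₄ mv (prev i) (shift u 0 a) (shift u 1 b) (shift u′ 1 c) (shift u 3 d))
        where
        i₁ = next i
        i₂ = next i₁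
        i₃ = next i₂
        shift = from-prev i

      admissible₂-at : v* ∈ S → ∀ i → T (admissible₂ (occupancy i) (occupancy (next i)) (occupancy (rotate 2 i)))
      admissible₂-at v*∈S i =
        excluded₂ (u′ i) (u′ i₁) (λ a b → v*∈S⇒¬u′₁u′₂ mv (prev i) v*∈S (shift u′ 0 a) (shift u′ 1 b)) ∧ᵀ
        excluded₂ (u′ i₁) (u′ i₂) (v*∈S⇒¬u′₁u′₂ mv i v*∈S) ∧ᵀ
        excluded₃ (u i) (u i₁) (u′ i₂) (λ a b c → ¬u₁u₂u′₃ mv (prev i) (shift u 0 a) (shift u 1 b) (shift u′ 2 c)) ∧ᵀ
        excluded₃ (u′ i) (u i₁) (u i₂) (λ a b c → ¬u′₁u₂u₃ mv (prev i) (shift u′ 0 a) (shift u 1 b) (shift u 2 c))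
        where
        i₁ = next i
        i₂ = next i₁
        shift = from-prev i

      ∑size-without-closed : (∀ i → ¬ Closed i) → 4 * ∑[ i < n ] size (occupancy i) ≤ n * 5
      ∑size-without-closed no-closed = potential-bound (size ∘ occupancy) Φ 4 5
        (λ i → potential₁-step _ _ _ _ (admissible₁-at no-closed i))
        where
        Φ : Fin n → ℕ
        Φ i = φ₁ (occupancy i) (occupancy (next i)) (occupancy (rotate 2 i))

      ∑size-with-v* : v* ∈ S → ∑[ i < n ] size (occupancy i) ≤ n
      ∑size-with-v* v*∈S = subst₂ _≤_ (*-identityˡ _) (*-identityʳ n) (potential-bound (size ∘ occupancy) Φ 1 1
        (λ i → potential₂-step _ _ _ (admissible₂-at v*∈S i)))
        where
        Φ : Fin n → ℕ
        Φ i = φ₂ (occupancy i) (occupancy (next i))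

      -- With v* ∉ S, a closed triple confines S to the 16 vertices around it.
      module _ (v*∉S : v* ∉ S) {h : Fin n} (closed : Closed h) where

        B : Fin n
        B = rotate (n ∸ 4) h

        ⟨_⟩ : ℕ → Fin n
        ⟨ a ⟩ = rotate a B

        ⟨4⟩≡h : ⟨ 4 ⟩ ≡ h
        ⟨4⟩≡h = begin
          rotate 4 (rotate (n ∸ 4) h) ≡⟨ rotate-+ 4 (n ∸ 4) h ⟩
          rotate (4 + (n ∸ 4)) h      ≡⟨ cong (λ k → rotate k h) (m+[n∸m]≡n (≤-trans (s≤s (s≤s (s≤s (s≤s z≤n)))) 8≤n)) ⟩
          rotate n h                  ≡⟨ rotate-period h ⟩
          h                           ∎
          where open ≡-Reasoning

        u′₄ : u′ ⟨ 4 ⟩ ∈ S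
        u′₄ = subst (λ j → u′ j ∈ S) (sym ⟨4⟩≡h) (proj₁ closed)

        u₅ : u ⟨ 5 ⟩ ∈ S
        u₅ = subst (λ j → u (next j) ∈ S) (sym ⟨4⟩≡h) (proj₁ (proj₂ closed))

        u′₆ : u′ ⟨ 6 ⟩ ∈ S
        u′₆ = subst (λ j → u′ (next (next j)) ∈ S) (sym ⟨4⟩≡h) (proj₂ (proj₂ closed))

        u₄∉S : u ⟨ 4 ⟩ ∉ S
        u₄∉S u₄ = ¬u₁u₂u′₃ mv ⟨ 3 ⟩ u₄ u₅ u′₆

        u₆∉S : u ⟨ 6 ⟩ ∉ S
        u₆∉S u₆ = ¬u′₁u₂u₃ mv ⟨ 3 ⟩ u′₄ u₅ u₆

        vertex : Bool → Fin n → V M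
        vertex false = u
        vertex true = u′

        slot : Bool × ℕ → V M
        slot (p , k) = vertex p ⟨ k ⟩

        left right centre-free centre : List (Bool × ℕ)
        left = (false , 3) ∷ (false , 2) ∷ (false , 1) ∷ (true , 2) ∷ (true , 3) ∷ []
        right = (false , 7) ∷ (false , 8) ∷ (false , 9) ∷ (true , 8) ∷ (true , 7) ∷ []
        centre-free = (false , 4) ∷ (false , 6) ∷ []
        centre = (false , 5) ∷ (true , 4) ∷ (true , 5) ∷ (true , 6) ∷ []

        count-left : countIn _≟ᵛ_ S (map slot left) ≤ 3
        count-left = group-bound (u ⟨ 3 ⟩ ∈ᵇ S) (u ⟨ 2 ⟩ ∈ᵇ S) (u ⟨ 1 ⟩ ∈ᵇ S) (u′ ⟨ 2 ⟩ ∈ᵇ S) (u′ ⟨ 3 ⟩ ∈ᵇ S)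
          (excluded₂ (u ⟨ 3 ⟩) (u ⟨ 2 ⟩)
             (λ u₃ u₂ → ¬u₁u₂u′₃ mv ⟨ 1 ⟩ u₂ u₃ u′₄) ∧ᵀ
           excluded₂ (u ⟨ 3 ⟩) (u′ ⟨ 2 ⟩)
             (λ u₃ u′₂ → ¬u′₁u₂u′₃u₄u′₅ mv ⟨ 1 ⟩ u′₂ u₃ u′₄ u₅ u′₆) ∧ᵀ
           excluded₃ (u ⟨ 2 ⟩) (u ⟨ 1 ⟩) (u′ ⟨ 3 ⟩)
             (λ u₂ u₁ u′₃ → ¬u₁u₂u′₃ mv B u₁ u₂ u′₃))

        count-right : countIn _≟ᵛ_ S (map slot right) ≤ 3
        count-right = group-bound (u ⟨ 7 ⟩ ∈ᵇ S) (u ⟨ 8 ⟩ ∈ᵇ S) (u ⟨ 9 ⟩ ∈ᵇ S) (u′ ⟨ 8 ⟩ ∈ᵇ S) (u′ ⟨ 7 ⟩ ∈ᵇ S)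
          (excluded₂ (u ⟨ 7 ⟩) (u ⟨ 8 ⟩)
             (λ u₇ u₈ → ¬u′₁u₂u₃ mv ⟨ 5 ⟩ u′₆ u₇ u₈) ∧ᵀ
           excluded₂ (u ⟨ 7 ⟩) (u′ ⟨ 8 ⟩)
             (λ u₇ u′₈ → ¬u′₁u₂u′₃u₄u′₅ mv ⟨ 3 ⟩ u′₄ u₅ u′₆ u₇ u′₈) ∧ᵀ
           excluded₃ (u ⟨ 8 ⟩) (u ⟨ 9 ⟩) (u′ ⟨ 7 ⟩)
             (λ u₈ u₉ u′₇ → ¬u′₁u₂u₃ mv ⟨ 6 ⟩ u′₇ u₈ u₉))

        count-centre-free : countIn _≟ᵛ_ S (map slot centre-free) ≡ 0
        count-centre-free = cong₂ (λ a b → a + (b + 0)) (cong 𝟙 (dec-false (u ⟨ 4 ⟩ ∈? S) u₄∉S)) (cong 𝟙 (dec-false (u ⟨ 6 ⟩ ∈? S) u₆∉S))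

        slots : List (Bool × ℕ)
        slots = left ++ right ++ centre-free ++ centre

        near-∈ : ∀ p {j d} → d ≤ 5 → (∀ {c} → c < d → (p , c + 5) ∈ slots × (p , 5 ∸ c) ∈ slots) →
                 dist ⟨ 5 ⟩ j < d → vertex p j ∈ map slot slots
        near-∈ p {j} d≤5 cover near
          with apart-rotate⁻ B 5 (dist-apart ⟨ 5 ⟩ j (≤-trans near d≤5)) (≤-trans (<⇒≤ near) d≤5)
        ... | inj₁ j≡ = subst (λ j → vertex p j ∈ map slot slots) (sym j≡) (∈-map⁺ slot (proj₁ (cover near)))
        ... | inj₂ j≡ = subst (λ j → vertex p j ∈ map slot slots) (sym j≡) (∈-map⁺ slot (proj₂ (cover near)))

        S⊆slots : ∀ {x} → x ∈ S → x ∈ map slot slots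
        S⊆slots {u j} u∈S = near-∈ false ≤-refl
          (toWitness {a? = allUpTo? (λ c → ((false , c + 5) ∈?ˢ slots) ×-dec ((false , 5 ∸ c) ∈?ˢ slots)) 5} tt)
          (closed⇒u-near mv ⟨ 3 ⟩ u′₄ u₅ u′₆ u∈S)
        S⊆slots {u′ j} u′∈S = near-∈ true (n≤1+n 4)
          (toWitness {a? = allUpTo? (λ c → ((true , c + 5) ∈?ˢ slots) ×-dec ((true , 5 ∸ c) ∈?ˢ slots)) 4} tt)
          (closed⇒u′-near mv ⟨ 3 ⟩ u′₄ u₅ u′₆ u′∈S)
        S⊆slots {v*} v*∈S = ⊥-elim (v*∉S v*∈S)

        length≤10 : Unique S → length S ≤ 10
        length≤10 unique = begin
          length S                                        ≤⟨ length≤countIn _≟ᵛ_ unique S⊆slots ⟩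
          # (left ++ right ++ centre-free ++ centre)       ≡⟨ split left (right ++ centre-free ++ centre) ⟩
          # left + # (right ++ centre-free ++ centre)      ≡⟨ cong (# left +_) (split right (centre-free ++ centre)) ⟩
          # left + (# right + # (centre-free ++ centre))   ≡⟨ cong (λ k → # left + (# right + k)) (split centre-free centre) ⟩
          # left + (# right + (# centre-free + # centre))
            ≤⟨ +-mono-≤ count-left (+-mono-≤ count-right
                 (+-mono-≤ (≤-reflexive count-centre-free) (countIn≤length _≟ᵛ_ S (map slot centre)))) ⟩
          10                                              ∎
          where
          open ≤-Reasoning
          # : List (Bool × ℕ) → ℕ
          # ss = countIn _≟ᵛ_ S (map slot ss)
          split : ∀ ss ts → # (ss ++ ts) ≡ # ss + # ts
          split ss ts = trans (cong (countIn _≟ᵛ_ S) (map-++ slot ss ts)) (countIn-++ _≟ᵛ_ S (map slot ss) (map slot ts))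

  2≤n/4 : 2 ≤ n / 4
  2≤n/4 = /-monoˡ-≤ 4 8≤n

  upper-bound : ∀ S → Unique S → IsMutualVisibilitySet M S → length S ≤ n + n / 4
  upper-bound S unique mv with v* ∈? S
  ... | yes v*∈S = begin
    length S                      ≤⟨ length≤∑size S unique ⟩
    ∑size + 𝟙 (v* ∈ᵇ S)           ≡⟨ cong (∑size +_) (cong 𝟙 (dec-true (v* ∈? S) v*∈S)) ⟩
    ∑size + 1                     ≤⟨ +-mono-≤ (∑size-with-v* S mv v*∈S) (≤-trans (s≤s z≤n) 2≤n/4) ⟩
    n + n / 4                     ∎
    where
    open ≤-Reasoning
    ∑size = ∑[ i < n ] size (occupancy S i)
  ... | no v*∉S with any? (closed? S)
  ...   | yes (h , closed) = ≤-trans (length≤10 S mv v*∉S closed unique) (+-mono-≤ 8≤n 2≤n/4)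
  ...   | no no-closed = begin
    length S                      ≤⟨ length≤∑size S unique ⟩
    ∑size + 𝟙 (v* ∈ᵇ S)           ≡⟨ cong (∑size +_) (cong 𝟙 (dec-false (v* ∈? S) v*∉S)) ⟩
    ∑size + 0                     ≡⟨ +-identityʳ ∑size ⟩
    ∑size                         ≤⟨ quarter-bound n ∑size (∑size-without-closed S mv (λ i closed → no-closed (i , closed))) ⟩
    n + n / 4                     ∎
    where
    open ≤-Reasoning
    ∑size = ∑[ i < n ] size (occupancy S i)

module Construction (m : ℕ) (8≤n : 8 ≤ suc m) where
  open Rotation m
  open CyclicDistance m
  open MycielskianOfCycle m (≤-trans (s≤s (s≤s z≤n)) 8≤n)

  -- Unlike _% 4, mod4 (4 + t) reduces to mod4 t, which makes sums over whole blocks compute.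
  mod4 : ℕ → ℕ
  mod4 (suc (suc (suc (suc t)))) = mod4 t
  mod4 t = t

  q : ℕ
  q = n / 4

  blockU blockU′ : ℕ → Bool
  blockU 0 = true
  blockU 2 = true
  blockU _ = false
  blockU′ 1 = false
  blockU′ _ = true

  inBlocks chooseU chooseU′ : ℕ → Bool
  inBlocks t = does (t <? q * 4)
  chooseU t = inBlocks t ∧ blockU (mod4 t)
  chooseU′ t = not (inBlocks t) ∨ blockU′ (mod4 t)

  chosen : V M → Bool
  chosen (u i) = chooseU (toℕ i)
  chosen (u′ i) = chooseU′ (toℕ i)
  chosen v* = false

  S₀ : List (V M)
  S₀ = filterᵇ chosen (tabulate u ++ tabulate u′)

  ∑-blockU : ∀ k → ∑[ i < k * 4 ] 𝟙 (blockU (mod4 (toℕ i))) ≡ k * 2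
  ∑-blockU zero = refl
  ∑-blockU (suc k) = cong (2 +_) (∑-blockU k)

  ∑-blockU′ : ∀ k → ∑[ i < k * 4 ] 𝟙 (blockU′ (mod4 (toℕ i))) ≡ k * 3
  ∑-blockU′ zero = refl
  ∑-blockU′ (suc k) = cong (3 +_) (∑-blockU′ k)

  n≡q*4+n%4 : n ≡ q * 4 + n % 4
  n≡q*4+n%4 = trans (m≡m%n+[m/n]*n n 4) (+-comm (n % 4) (q * 4))

  inBlocks-< : ∀ {t} → t < q * 4 → inBlocks t ≡ true
  inBlocks-< t<q*4 = dec-true (_ <? q * 4) t<q*4

  inBlocks-≥ : ∀ t → inBlocks (q * 4 + t) ≡ false
  inBlocks-≥ t = dec-false (q * 4 + t <? q * 4) (m+n≮m (q * 4) t)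

  ∑-chooseU : ∑[ i < n ] 𝟙 (chooseU (toℕ i)) ≡ q * 2
  ∑-chooseU = begin
    ∑[ i < n ] 𝟙 (chooseU (toℕ i))
      ≡⟨ cong (λ k → ∑[ i < k ] 𝟙 (chooseU (toℕ i))) n≡q*4+n%4 ⟩
    ∑[ i < q * 4 + n % 4 ] 𝟙 (chooseU (toℕ i))
      ≡⟨ ∑-+ (q * 4) (n % 4) (𝟙 ∘ chooseU) ⟩
    ∑[ i < q * 4 ] 𝟙 (chooseU (toℕ i)) + ∑[ i < n % 4 ] 𝟙 (chooseU (q * 4 + toℕ i))
      ≡⟨ cong₂ _+_ (sum-cong-≗ {q * 4} λ i → cong (λ b → 𝟙 (b ∧ blockU (mod4 (toℕ i)))) (inBlocks-< (toℕ<n i)))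
                   (sum-cong-≗ {n % 4} λ i → cong (λ b → 𝟙 (b ∧ blockU (mod4 (q * 4 + toℕ i)))) (inBlocks-≥ (toℕ i))) ⟩
    ∑[ i < q * 4 ] 𝟙 (blockU (mod4 (toℕ i))) + ∑[ i < n % 4 ] 0
      ≡⟨ cong₂ _+_ (∑-blockU q) (trans (∑-const (n % 4) 0) (*-zeroʳ (n % 4))) ⟩
    q * 2 + 0
      ≡⟨ +-identityʳ (q * 2) ⟩
    q * 2 ∎
    where open ≡-Reasoning

  ∑-chooseU′ : ∑[ i < n ] 𝟙 (chooseU′ (toℕ i)) ≡ q * 3 + n % 4
  ∑-chooseU′ = begin
    ∑[ i < n ] 𝟙 (chooseU′ (toℕ i))
      ≡⟨ cong (λ k → ∑[ i < k ] 𝟙 (chooseU′ (toℕ i))) n≡q*4+n%4 ⟩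
    ∑[ i < q * 4 + n % 4 ] 𝟙 (chooseU′ (toℕ i))
      ≡⟨ ∑-+ (q * 4) (n % 4) (𝟙 ∘ chooseU′) ⟩
    ∑[ i < q * 4 ] 𝟙 (chooseU′ (toℕ i)) + ∑[ i < n % 4 ] 𝟙 (chooseU′ (q * 4 + toℕ i))
      ≡⟨ cong₂ _+_ (sum-cong-≗ {q * 4} λ i → cong (λ b → 𝟙 (not b ∨ blockU′ (mod4 (toℕ i)))) (inBlocks-< (toℕ<n i)))
                   (sum-cong-≗ {n % 4} λ i → cong (λ b → 𝟙 (not b ∨ blockU′ (mod4 (q * 4 + toℕ i)))) (inBlocks-≥ (toℕ i))) ⟩
    ∑[ i < q * 4 ] 𝟙 (blockU′ (mod4 (toℕ i))) + ∑[ i < n % 4 ] 1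
      ≡⟨ cong₂ _+_ (∑-blockU′ q) (trans (∑-const (n % 4) 1) (*-identityʳ (n % 4))) ⟩
    q * 3 + n % 4 ∎
    where open ≡-Reasoning

  length-S₀ : length S₀ ≡ n + n / 4
  length-S₀ = begin
    length S₀
      ≡⟨ cong length (filter-++ (T? ∘ chosen) (tabulate u) (tabulate u′)) ⟩
    length (filterᵇ chosen (tabulate u) ++ filterᵇ chosen (tabulate u′))
      ≡⟨ length-++ (filterᵇ chosen (tabulate u)) ⟩
    length (filterᵇ chosen (tabulate u)) + length (filterᵇ chosen (tabulate u′))
      ≡⟨ cong₂ _+_ (length-filterᵇ-tabulate chosen u) (length-filterᵇ-tabulate chosen u′) ⟩
    ∑[ i < n ] 𝟙 (chooseU (toℕ i)) + ∑[ i < n ] 𝟙 (chooseU′ (toℕ i))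
      ≡⟨ cong₂ _+_ ∑-chooseU ∑-chooseU′ ⟩
    q * 2 + (q * 3 + n % 4)
      ≡⟨ regroup q (n % 4) ⟩
    (q * 4 + n % 4) + q
      ≡⟨ cong (_+ q) n≡q*4+n%4 ⟨
    n + q ∎
    where
    open ≡-Reasoning
    regroup : ∀ q r → q * 2 + (q * 3 + r) ≡ (q * 4 + r) + q
    regroup = solve-∀

  ∈S₀⇒chosen : ∀ {x} → x ∈ S₀ → T (chosen x)
  ∈S₀⇒chosen = proj₂ ∘ ∈-filter⁻ (T? ∘ chosen) {xs = tabulate u ++ tabulate u′}

  unchosen⇒∉S₀ : ∀ {x} → ¬ T (chosen x) → x ∉ S₀
  unchosen⇒∉S₀ unchosen = unchosen ∘ ∈S₀⇒chosen

  S₀-unique : Unique S₀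
  S₀-unique = filter⁺ (T? ∘ chosen) {xs = tabulate u ++ tabulate u′}
    (++⁺ (tabulate⁺ {f = u} λ { refl → refl }) (tabulate⁺ {f = u′} λ { refl → refl }) u≢u′)
    where
    u≢u′ : ∀ {x} → ¬ (x ∈ tabulate u × x ∈ tabulate u′)
    u≢u′ (x∈u , x∈u′) with ∈-tabulate⁻ {f = u} x∈u | ∈-tabulate⁻ {f = u′} x∈u′
    ... | _ , refl | _ , ()

  mod4-*4 : ∀ k → mod4 (k * 4) ≡ 0
  mod4-*4 zero = refl
  mod4-*4 (suc k) = mod4-*4 k

  blockU-next : ∀ t → T (blockU (mod4 t)) → ¬ T (blockU (mod4 (suc t))) × mod4 (suc t) ≢ 0
  blockU-next 0 _ = (λ ()) , (λ ())
  blockU-next 2 _ = (λ ()) , (λ ())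
  blockU-next (suc (suc (suc (suc t)))) b = blockU-next t b

  blockU-hole : ∀ t → T (blockU (mod4 t)) → ¬ T (blockU′ (mod4 (suc t))) ⊎ ∃[ t' ] t ≡ suc t' × ¬ T (blockU′ (mod4 t'))
  blockU-hole 0 _ = inj₁ λ ()
  blockU-hole 2 _ = inj₂ (1 , refl , λ ())
  blockU-hole (suc (suc (suc (suc t)))) b with blockU-hole t b
  ... | inj₁ hole = inj₁ hole
  ... | inj₂ (t' , refl , hole) = inj₂ (4 + t' , refl , hole)

  chosen-u : ∀ {x} → u x ∈ S₀ → toℕ x < q * 4 × T (blockU (mod4 (toℕ x)))
  chosen-u {x} u∈S₀ with Equivalence.to T-∧ (∈S₀⇒chosen u∈S₀)
  ... | inBlocks , b = <ᵇ⇒< (toℕ x) (q * 4) inBlocks , b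

  suc<q*4 : ∀ {x} → u x ∈ S₀ → suc (toℕ x) < q * 4
  suc<q*4 {x} u∈S₀ with chosen-u u∈S₀
  ... | lt , b with m≤n⇒m<n∨m≡n lt
  ...   | inj₁ suc<q*4 = suc<q*4
  ...   | inj₂ suc≡q*4 = ⊥-elim (proj₂ (blockU-next (toℕ x) b) (trans (cong mod4 suc≡q*4) (mod4-*4 q)))

  toℕ-next-chosen : ∀ {x} → u x ∈ S₀ → toℕ (next x) ≡ suc (toℕ x)
  toℕ-next-chosen u∈S₀ = toℕ-next-< _ (<-≤-trans (suc<q*4 u∈S₀) (m/n*n≤m n 4))

  u-next∉S₀ : ∀ {x} → u x ∈ S₀ → u (next x) ∉ S₀
  u-next∉S₀ {x} u∈S₀ u-next∈S₀ with chosen-u u∈S₀ | chosen-u u-next∈S₀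
  ... | _ , b | _ , b′ = proj₁ (blockU-next (toℕ x) b) (subst (λ t → T (blockU (mod4 t))) (toℕ-next-chosen u∈S₀) b′)

  u′-unchosen : ∀ {j} → toℕ j < q * 4 → ¬ T (blockU′ (mod4 (toℕ j))) → u′ j ∉ S₀
  u′-unchosen {j} lt hole = unchosen⇒∉S₀ (subst (λ b → ¬ T (not b ∨ blockU′ (mod4 (toℕ j)))) (sym (inBlocks-< lt)) hole)

  u′-beside : ∀ {x} → u x ∈ S₀ → ∃[ x' ] CycleAdj n x x' × u′ x' ∉ S₀
  u′-beside {x} u∈S₀ with chosen-u u∈S₀
  ... | lt , b with blockU-hole (toℕ x) b
  ...   | inj₁ hole = next x , CycleAdj-next x ,
          u′-unchosen (subst (_< q * 4) (sym next≡) (suc<q*4 u∈S₀)) (subst (λ t → ¬ T (blockU′ (mod4 t))) (sym next≡) hole)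
    where next≡ = toℕ-next-chosen u∈S₀
  ...   | inj₂ (t' , x≡ , hole) = prev x , next⇒CycleAdj (inj₂ (sym (next-prev x))) ,
          u′-unchosen (subst (_< q * 4) (sym prev≡) (<⇒≤ (subst (_< q * 4) x≡ lt))) (subst (λ t → ¬ T (blockU′ (mod4 t))) (sym prev≡) hole)
    where prev≡ = toℕ-prev x x≡

  v*∉S₀ : v* ∉ S₀
  v*∉S₀ = unchosen⇒∉S₀ λ ()

  δ-at : ∀ (f : ℕ → ℕ) {i j c} → dist i j ≡ c → f c ≤ f (dist i j)
  δ-at f d≡c = ≤-reflexive (cong f (sym d≡c))

  visible-uu : ∀ {a b} → u a ∈ S₀ → u b ∈ S₀ → Visible M S₀ (u a) (u b)
  visible-uu {a} {b} ua ub with dist-case a b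
  ... | short 0 _ _ (inj₁ refl) = visible-refl S₀
  ... | short 0 _ _ (inj₂ refl) = visible-refl S₀
  ... | short 1 _ d≡1 apart = visible-edge S₀ (next⇒CycleAdj apart) (δ-at δuu d≡1)
  ... | short 2 _ d≡2 (inj₁ refl) =
    visible-through₁ S₀ (CycleAdj-next a) (CycleAdj-next (next a)) (u-next∉S₀ ua) (δ-at δuu d≡2)
  ... | short 2 _ d≡2 (inj₂ refl) =
    visible-through₁ S₀ (CycleAdj-prev (next b)) (CycleAdj-prev b) (u-next∉S₀ ub) (δ-at δuu d≡2)
  ... | short 3 _ d≡3 (inj₁ refl) =
    visible-through₂ S₀ (CycleAdj-next a) (CycleAdj-next (next a)) (CycleAdj-next (rotate 2 a))
      (u-next∉S₀ ua) (λ u₂ → u-next∉S₀ u₂ ub) (δ-at δuu d≡3)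
  ... | short 3 _ d≡3 (inj₂ refl) =
    visible-through₂ S₀ (CycleAdj-prev (rotate 2 b)) (CycleAdj-prev (next b)) (CycleAdj-prev b)
      (λ u₂ → u-next∉S₀ u₂ ua) (u-next∉S₀ ub) (δ-at δuu d≡3)
  ... | short (suc (suc (suc (suc _)))) (s≤s (s≤s (s≤s (s≤s ())))) _ _
  ... | long 4≤d with u′-beside ua | u′-beside ub
  ...   | a′ , a~a′ , a′∉S₀ | b′ , b~b′ , b′∉S₀ =
    visible-through₃ S₀ {z₁ = u′ a′} {z₂ = v*} a~a′ tt tt (CycleAdj-sym b~b′) a′∉S₀ v*∉S₀ b′∉S₀ (4≤δuu 4≤d)

  visible-uu′ : ∀ {a} b → u a ∈ S₀ → Visible M S₀ (u a) (u′ b)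
  visible-uu′ {a} b ua with dist-case a b
  ... | short 0 _ d≡0 (inj₁ refl) =
    visible-through₁ S₀ (CycleAdj-next a) (CycleAdj-prev a) (u-next∉S₀ ua) (δ-at δuu′ d≡0)
  ... | short 0 _ d≡0 (inj₂ refl) =
    visible-through₁ S₀ (CycleAdj-next a) (CycleAdj-prev a) (u-next∉S₀ ua) (δ-at δuu′ d≡0)
  ... | short 1 _ d≡1 apart = visible-edge S₀ (next⇒CycleAdj apart) (δ-at δuu′ d≡1)
  ... | short 2 _ d≡2 (inj₁ refl) =
    visible-through₁ S₀ (CycleAdj-next a) (CycleAdj-next (next a)) (u-next∉S₀ ua) (δ-at δuu′ d≡2)
  ... | short 2 _ d≡2 (inj₂ refl) =
    visible-through₁ S₀ (CycleAdj-prev (next b)) (CycleAdj-prev b) (λ u₁ → u-next∉S₀ u₁ ua) (δ-at δuu′ d≡2)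
  ... | short 3 _ d≡3 _ with u′-beside ua
  ...   | a′ , a~a′ , a′∉S₀ = visible-through₂ S₀ {z₁ = u′ a′} {z₂ = v*} a~a′ tt tt a′∉S₀ v*∉S₀ (δ-at δuu′ d≡3)
  visible-uu′ {a} b ua | short (suc (suc (suc (suc _)))) (s≤s (s≤s (s≤s (s≤s ())))) _ _
  visible-uu′ {a} b ua | long 4≤d with u′-beside ua
  ...   | a′ , a~a′ , a′∉S₀ = visible-through₂ S₀ {z₁ = u′ a′} {z₂ = v*} a~a′ tt tt a′∉S₀ v*∉S₀ (3≤δuu′ (≤-trans (n≤1+n 3) 4≤d))

  visible-u′u : ∀ b {a} → u a ∈ S₀ → Visible M S₀ (u′ b) (u a)
  visible-u′u b {a} ua with dist-case b a
  ... | short 0 _ d≡0 (inj₁ refl) =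
    visible-through₁ S₀ (CycleAdj-next b) (CycleAdj-prev b) (u-next∉S₀ ua) (δ-at δuu′ d≡0)
  ... | short 0 _ d≡0 (inj₂ refl) =
    visible-through₁ S₀ (CycleAdj-next a) (CycleAdj-prev a) (u-next∉S₀ ua) (δ-at δuu′ d≡0)
  ... | short 1 _ d≡1 apart = visible-edge S₀ (next⇒CycleAdj apart) (δ-at δuu′ d≡1)
  ... | short 2 _ d≡2 (inj₁ refl) =
    visible-through₁ S₀ (CycleAdj-next b) (CycleAdj-next (next b)) (λ u₁ → u-next∉S₀ u₁ ua) (δ-at δuu′ d≡2)
  ... | short 2 _ d≡2 (inj₂ refl) =
    visible-through₁ S₀ (CycleAdj-prev (next a)) (CycleAdj-prev a) (u-next∉S₀ ua) (δ-at δuu′ d≡2)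
  ... | short 3 _ d≡3 _ with u′-beside ua
  ...   | a′ , a~a′ , a′∉S₀ =
    visible-through₂ S₀ {z₁ = v*} {z₂ = u′ a′} tt tt (CycleAdj-sym a~a′) v*∉S₀ a′∉S₀ (δ-at δuu′ d≡3)
  visible-u′u b {a} ua | short (suc (suc (suc (suc _)))) (s≤s (s≤s (s≤s (s≤s ())))) _ _
  visible-u′u b {a} ua | long 4≤d with u′-beside ua
  ...   | a′ , a~a′ , a′∉S₀ =
    visible-through₂ S₀ {z₁ = v*} {z₂ = u′ a′} tt tt (CycleAdj-sym a~a′) v*∉S₀ a′∉S₀ (3≤δuu′ (≤-trans (n≤1+n 3) 4≤d))

  visible-u′u′ : ∀ a b → Visible M S₀ (u′ a) (u′ b)
  visible-u′u′ a b with dist a b in d≡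
  ... | 0 = subst (λ b → Visible M S₀ (u′ a) (u′ b)) (dist≡0⇒≡ d≡) (visible-refl S₀)
  ... | suc c = visible-through₁ S₀ {z = v*} tt tt v*∉S₀ (δ-at δu′u′ d≡)

  S₀-mutually-visible : IsMutualVisibilitySet M S₀
  S₀-mutually-visible (u a) (u b) ua ub = visible-uu ua ub
  S₀-mutually-visible (u a) (u′ b) ua _ = visible-uu′ b ua
  S₀-mutually-visible (u′ a) (u b) _ ub = visible-u′u a ub
  S₀-mutually-visible (u′ a) (u′ b) _ _ = visible-u′u′ a b
  S₀-mutually-visible v* _ v*∈S₀ _ = ⊥-elim (v*∉S₀ v*∈S₀)
  S₀-mutually-visible _ v* _ v*∈S₀ = ⊥-elim (v*∉S₀ v*∈S₀)

theorem5p2 : (n : ℕ) → 8 ≤ n → MuEquals (Mycielskian (Cycle n)) (n + n / 4)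
theorem5p2 (suc m) 8≤n = (S₀ , S₀-unique , S₀-mutually-visible , length-S₀) , upper-bound
  where
  open Construction m 8≤n
  open UpperBound m 8≤n
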